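{- Let $a,b\in\mathbb{Z}[i]\setminus\{0\}$ have non-zero Gauss remainder $r$. If $\phi_{\mathbb{Z}[i]}(r)\geq\phi_{\mathbb{Z}[i]}(b)=n$ and $\Im(u_b b)\,\Im(u_r r)\geq 0$, then $\phi_{\mathbb{Z}[i]}\left(r-\frac{u_b}{u_r}b\right)<\phi_{\mathbb{Z}[i]}(b)$.
   Context: $\mathbb{Z}[i]=\{x+yi : x,y\in\mathbb{Z}\}$ with units $\pm1,\pm i$ and norm $\mathrm{Nm}(x+yi)=x^2+y^2$. A function $f:\mathbb{Z}[i]\setminus\{0\}\to W$ ($W$ a well-ordered set having $\mathbb{N}$ as an initial segment) is Euclidean if for all nonzero $a,b$ there exist $q,r$ with $a=qb+r$ and either $r=0$ or $f(r)<f(b)$. $\phi_{\mathbb{Z}[i]}$ denotes the minimal Euclidean function, the pointwise minimum of all Euclidean functions on $\mathbb{Z}[i]\setminus\{0\}$ (equivalently, $\phi_{\mathbb{Z}[i]}(z)$ is the minimal $n$ such that $z=\sum_{j=0}^n u_j(1+i)^j$ with $u_j\in\{0,\pm1,\pm i\}$, $u_n\neq0$). Gauss remainder: for nonzero $a,b$, write $a\bar b/\mathrm{Nm}(b)=\alpha+\beta i$; let $\lfloor x\rceil=\lfloor x\rfloor$ if $0\le x-\lfloor x\rfloor\le 1/2$ and $\lceil x\rceil$ otherwise; the Gauss quotient is $q=\lfloor\alpha\rceil+\lfloor\beta\rceil i$ and the Gauss remainder is $r=a-qb$. For $z=x+yi$: $\ell_\infty(z)=\max(|x|,|y|)$, $m(z)=\min(|x|,|y|)$.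 For $z\neq0$, $u_z$ is the unique unit with $\Re(u_z z)=\ell_\infty(z)$ if $\ell_\infty(z)\neq m(z)$, and the unique unit with $u_z z=\ell_\infty(z)(1+i)$ if $\ell_\infty(z)=m(z)$. -}

module Defs where

open import Data.Nat as ℕ using (ℕ; zero; suc)
open import Data.Integer as ℤ using (ℤ; +_; _/ℕ_; _%ℕ_; ∣_∣)
open import Data.Bool using (if_then_else_)
open import Data.Vec using (Vec; []; _∷_; last)
open import Data.Product using (Σ; _×_; _,_)
open import Relation.Binary.PropositionalEquality using (_≡_; _≢_)
open import Relation.Nullary using (¬_)
open import Relation.Nullary.Decidable using (⌊_⌋)

record ℤ[i] : Set where
  constructor _+_i
  field
    re : ℤ
    im : ℤ
open ℤ[i] public

0ᵍ : ℤ[i]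
0ᵍ = (+ 0) + (+ 0) i

1+i : ℤ[i]
1+i = (+ 1) + (+ 1) i

infixl 6 _+ᵍ_ _-ᵍ_
infixl 7 _*ᵍ_

_+ᵍ_ : ℤ[i] → ℤ[i] → ℤ[i]
(a + b i) +ᵍ (c + d i) = (a ℤ.+ c) + (b ℤ.+ d) i

_-ᵍ_ : ℤ[i] → ℤ[i] → ℤ[i]
(a + b i) -ᵍ (c + d i) = (a ℤ.- c) + (b ℤ.- d) i

_*ᵍ_ : ℤ[i] → ℤ[i] → ℤ[i]
(a + b i) *ᵍ (c + d i) = (a ℤ.* c ℤ.- b ℤ.* d) + (a ℤ.* d ℤ.+ b ℤ.* c) i

conj : ℤ[i] → ℤ[i]
conj (a + b i) = a + (ℤ.- b) i

Nm : ℤ[i] → ℕ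
Nm (a + b i) = ∣ a ∣ ℕ.* ∣ a ∣ ℕ.+ ∣ b ∣ ℕ.* ∣ b ∣

data Unit : Set where
  u1 u-1 ui u-i : Unit

toℤ[i] : Unit → ℤ[i]
toℤ[i] u1  = (+ 1) + (+ 0) i
toℤ[i] u-1 = (ℤ.- (+ 1)) + (+ 0) i
toℤ[i] ui  = (+ 0) + (+ 1) i
toℤ[i] u-i = (+ 0) + (ℤ.- (+ 1)) i

-- u / v for units u, v  (v⁻¹ = conj v for a unit v)
_/ᵘ_ : Unit → Unit → ℤ[i]
u /ᵘ v = toℤ[i] u *ᵍ conj (toℤ[i] v)

data Digit : Set where
  d0 : Digit
  du : Unit → Digit

digitVal : Digit → ℤ[i]
digitVal d0     = 0ᵍ
digitVal (du u) = toℤ[i] u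

-- Σ_j d_j (1+i)^j  (Horner evaluation, d_0 first)
evalDigits : ∀ {k} → Vec Digit k → ℤ[i]
evalDigits []       = 0ᵍ
evalDigits (d ∷ ds) = digitVal d +ᵍ 1+i *ᵍ evalDigits ds

-- z = Σ_{j=0}^n u_j (1+i)^j with u_j ∈ {0,±1,±i}, u_n ≠ 0
Repr : ℕ → ℤ[i] → Set
Repr n z = Σ (Vec Digit (suc n)) λ ds → (last ds ≢ d0) × (evalDigits ds ≡ z)

Phi : ℤ[i] → ℕ → Set
Phi z n = Repr n z × (∀ m → m ℕ.< n → ¬ Repr m z)

-- ⌊ X / N ⌉ : floor if the fractional part is ≤ 1/2, ceiling otherwise
roundDiv : ℤ → ℕ → ℤ
roundDiv X zero    = + 0
roundDiv X (suc k) =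
  if ⌊ 2 ℕ.* (X %ℕ suc k) ℕ.≤? suc k ⌋
  then X /ℕ suc k
  else (X /ℕ suc k) ℤ.+ + 1

-- Gauss quotient and remainder: a conj(b) / Nm(b) = α + β i
gaussQuot : ℤ[i] → ℤ[i] → ℤ[i]
gaussQuot a b = let w = a *ᵍ conj b in
  roundDiv (re w) (Nm b) + roundDiv (im w) (Nm b) i

gaussRem : ℤ[i] → ℤ[i] → ℤ[i]
gaussRem a b = a -ᵍ gaussQuot a b *ᵍ b

ℓ∞ : ℤ[i] → ℕ
ℓ∞ (x + y i) = ∣ x ∣ ℕ.⊔ ∣ y ∣

mᵍ : ℤ[i] → ℕ
mᵍ (x + y i) = ∣ x ∣ ℕ.⊓ ∣ y ∣

IsUz : ℤ[i] → Unit → Set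
IsUz z u =
  (ℓ∞ z ≢ mᵍ z → re (toℤ[i] u *ᵍ z) ≡ + ℓ∞ z) ×
  (ℓ∞ z ≡ mᵍ z → toℤ[i] u *ᵍ z ≡ (+ ℓ∞ z) + (+ ℓ∞ z) i)

{-# OPTIONS --safe #-}
-- Let B_k = {0} ∪ {φ ≤ k}, the values of (k + 1)-digit expansions in base 1 + i.
-- Multiplying by u_r (and conjugating if u_r r and u_b b lie below the real
-- axis) maps r and (u_b/u_r) b to points r′ = x₁ + y₁ i and b′ = x₂ + y₂ i of the
-- octant 0 ≤ y ≤ x, so it suffices to show 0 ≠ r′ - b′ ∈ B_{n-1}. The Gauss
-- remainder satisfies 2 ℓ∞ r ≤ ℓ1 b and ℓ1 r ≤ ℓ∞ b, i.e. 2 x₁ ≤ x₂ + y₂ and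
-- x₁ + y₁ ≤ x₂. The odd elements (odd ℓ1) of B_k are exactly the odd points of
-- an octagon ℓ∞ ≤ L k, ℓ1 ≤ S k, and an even z lies in B_{k+1} iff z/(1+i) lies
-- in B_k. As r′ ∉ B_{n-1}, r′ is even and lies outside a square and a diamond
-- contained in B_{n-1}. If b′ is odd, then r′ - b′ is odd and these bounds put it
-- into the octagon of B_{n-1}. If b′ is even too, dividing both points by 1 + i
-- and conjugating gives octant points satisfying the same two inequalities with
-- their roles swapped, and induction on n concludes.
module Submission where

open import Defs
open import Data.Nat using (ℕ; _≤_; _<_)
open import Data.Integer as ℤ using (+_)
open import Data.Product using (∃; _×_)
open import Relation.Binary.PropositionalEquality using (_≡_; _≢_)

open import Algebra.Bundles using (CommutativeRing)
open import Algebra.Consequences.Propositional using (comm∧idˡ⇒idʳ; comm∧invˡ⇒invʳ; comm∧distrˡ⇒distrʳ)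
open import Data.Bool using (Bool; true; false)
open import Data.Empty using (⊥-elim)
open import Data.Integer using (ℤ; -[1+_]; ∣_∣)
import Data.Integer.DivMod as ℤ/
import Data.Integer.Properties as ℤₚ
import Data.Integer.Tactic.RingSolver as ℤ-Solver
import Data.Nat as ℕ
open import Data.Nat using (zero; suc; _+_; _*_; _⊔_; _∸_; z≤n; s≤s; ∣_-_∣)
import Data.Nat.Induction as ℕ-Ind
import Data.Nat.Properties as ℕₚ
import Data.Nat.Tactic.RingSolver as ℕ-Solver
open import Algebra.Properties.CommutativeSemigroup ℕₚ.+-commutativeSemigroup
  using () renaming (interchange to +-interchange)
open import Data.Product using (Σ; _,_; proj₁; proj₂)
open import Data.Sum using (_⊎_; inj₁; inj₂; [_,_]′)
open import Data.Vec using (Vec; []; _∷_; last)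
open import Relation.Binary.PropositionalEquality
  using (refl; sym; trans; cong; cong₂; subst; subst₂; isEquivalence; module ≡-Reasoning)
open import Relation.Nullary using (¬_; Dec; yes; no)
open import Relation.Nullary.Decidable using (map′; _×-dec_; dec⇒maybe)
open import Tactic.RingSolver using (solve-∀)
open import Tactic.RingSolver.Core.AlmostCommutativeRing using (AlmostCommutativeRing; fromCommutativeRing)

negᵍ : ℤ[i] → ℤ[i]
negᵍ (a + b i) = (ℤ.- a) + (ℤ.- b) i

1ᵍ : ℤ[i]
1ᵍ = (+ 1) + (+ 0) i

_≟ᵍ_ : (u v : ℤ[i]) → Dec (u ≡ v)
(a + b i) ≟ᵍ (c + d i) =
  map′ (λ (a≡c , b≡d) → cong₂ _+_i a≡c b≡d) (λ u≡v → cong re u≡v , cong im u≡v) (a ℤ.≟ c ×-dec b ℤ.≟ d)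

+ᵍ-assoc : ∀ u v w → (u +ᵍ v) +ᵍ w ≡ u +ᵍ (v +ᵍ w)
+ᵍ-assoc (a + b i) (c + d i) (e + f i) = cong₂ _+_i (ℤₚ.+-assoc a c e) (ℤₚ.+-assoc b d f)

+ᵍ-comm : ∀ u v → u +ᵍ v ≡ v +ᵍ u
+ᵍ-comm (a + b i) (c + d i) = cong₂ _+_i (ℤₚ.+-comm a c) (ℤₚ.+-comm b d)

+ᵍ-identityˡ : ∀ u → 0ᵍ +ᵍ u ≡ u
+ᵍ-identityˡ (a + b i) = cong₂ _+_i (ℤₚ.+-identityˡ a) (ℤₚ.+-identityˡ b)

negᵍ-inverseˡ : ∀ u → negᵍ u +ᵍ u ≡ 0ᵍ
negᵍ-inverseˡ (a + b i) = cong₂ _+_i (ℤₚ.+-inverseˡ a) (ℤₚ.+-inverseˡ b)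

*ᵍ-assoc : ∀ u v w → (u *ᵍ v) *ᵍ w ≡ u *ᵍ (v *ᵍ w)
*ᵍ-assoc (a + b i) (c + d i) (e + f i) = cong₂ _+_i (re-assoc a b c d e f) (im-assoc a b c d e f)
  where
  re-assoc : ∀ a b c d e f → (a ℤ.* c ℤ.- b ℤ.* d) ℤ.* e ℤ.- (a ℤ.* d ℤ.+ b ℤ.* c) ℤ.* f
                           ≡ a ℤ.* (c ℤ.* e ℤ.- d ℤ.* f) ℤ.- b ℤ.* (c ℤ.* f ℤ.+ d ℤ.* e)
  re-assoc = ℤ-Solver.solve-∀
  im-assoc : ∀ a b c d e f → (a ℤ.* c ℤ.- b ℤ.* d) ℤ.* f ℤ.+ (a ℤ.* d ℤ.+ b ℤ.* c) ℤ.* e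
                           ≡ a ℤ.* (c ℤ.* f ℤ.+ d ℤ.* e) ℤ.+ b ℤ.* (c ℤ.* e ℤ.- d ℤ.* f)
  im-assoc = ℤ-Solver.solve-∀

*ᵍ-comm : ∀ u v → u *ᵍ v ≡ v *ᵍ u
*ᵍ-comm (a + b i) (c + d i) = cong₂ _+_i (cong₂ ℤ._-_ (ℤₚ.*-comm a c) (ℤₚ.*-comm b d))
  (trans (ℤₚ.+-comm (a ℤ.* d) (b ℤ.* c)) (cong₂ ℤ._+_ (ℤₚ.*-comm b c) (ℤₚ.*-comm a d)))

*ᵍ-identityˡ : ∀ u → 1ᵍ *ᵍ u ≡ u
*ᵍ-identityˡ (a + b i) = cong₂ _+_i (re-identity a b) (im-identity a b)
  where
  re-identity : ∀ a b → + 1 ℤ.* a ℤ.- + 0 ℤ.* b ≡ a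
  re-identity = ℤ-Solver.solve-∀
  im-identity : ∀ a b → + 1 ℤ.* b ℤ.+ + 0 ℤ.* a ≡ b
  im-identity = ℤ-Solver.solve-∀

*ᵍ-distribˡ-+ᵍ : ∀ u v w → u *ᵍ (v +ᵍ w) ≡ u *ᵍ v +ᵍ u *ᵍ w
*ᵍ-distribˡ-+ᵍ (a + b i) (c + d i) (e + f i) = cong₂ _+_i (re-distrib a b c d e f) (im-distrib a b c d e f)
  where
  re-distrib : ∀ a b c d e f → a ℤ.* (c ℤ.+ e) ℤ.- b ℤ.* (d ℤ.+ f)
                             ≡ (a ℤ.* c ℤ.- b ℤ.* d) ℤ.+ (a ℤ.* e ℤ.- b ℤ.* f)
  re-distrib = ℤ-Solver.solve-∀
  im-distrib : ∀ a b c d e f → a ℤ.* (d ℤ.+ f) ℤ.+ b ℤ.* (c ℤ.+ e)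
                             ≡ (a ℤ.* d ℤ.+ b ℤ.* c) ℤ.+ (a ℤ.* f ℤ.+ b ℤ.* e)
  im-distrib = ℤ-Solver.solve-∀

ℤ[i]-commutativeRing : CommutativeRing _ _
ℤ[i]-commutativeRing = record
  { Carrier = ℤ[i] ; _≈_ = _≡_ ; _+_ = _+ᵍ_ ; _*_ = _*ᵍ_ ; -_ = negᵍ ; 0# = 0ᵍ ; 1# = 1ᵍ
  ; isCommutativeRing = record
    { isRing = record
      { +-isAbelianGroup = record
        { isGroup = record
          { isMonoid = record
            { isSemigroup = record
              { isMagma = record { isEquivalence = isEquivalence ; ∙-cong = cong₂ _+ᵍ_ }
              ; assoc = +ᵍ-assoc }
            ; identity = +ᵍ-identityˡ , comm∧idˡ⇒idʳ +ᵍ-comm +ᵍ-identityˡ }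
          ; inverse = negᵍ-inverseˡ , comm∧invˡ⇒invʳ +ᵍ-comm negᵍ-inverseˡ
          ; ⁻¹-cong = cong negᵍ }
        ; comm = +ᵍ-comm }
      ; *-cong = cong₂ _*ᵍ_
      ; *-assoc = *ᵍ-assoc
      ; *-identity = *ᵍ-identityˡ , comm∧idˡ⇒idʳ *ᵍ-comm *ᵍ-identityˡ
      ; distrib = *ᵍ-distribˡ-+ᵍ , comm∧distrˡ⇒distrʳ *ᵍ-comm *ᵍ-distribˡ-+ᵍ }
    ; *-comm = *ᵍ-comm } }

-- The ring solver recognises subtraction only in the shape u +ᵍ negᵍ v
-- (definitionally u -ᵍ v), so identities proved by solve-∀ ℤ[i]-ring are
-- stated in that shape, with conj (not a ring operation) moved out first.
ℤ[i]-ring : AlmostCommutativeRing _ _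
ℤ[i]-ring = fromCommutativeRing ℤ[i]-commutativeRing λ z → dec⇒maybe (0ᵍ ≟ᵍ z)

conj-+ᵍ : ∀ u v → conj (u +ᵍ v) ≡ conj u +ᵍ conj v
conj-+ᵍ (a + b i) (c + d i) = cong₂ _+_i refl (ℤₚ.neg-distrib-+ b d)

conj-*ᵍ : ∀ u v → conj (u *ᵍ v) ≡ conj u *ᵍ conj v
conj-*ᵍ (a + b i) (c + d i) = cong₂ _+_i (re-conj a b c d) (im-conj a b c d)
  where
  re-conj : ∀ a b c d → a ℤ.* c ℤ.- b ℤ.* d ≡ a ℤ.* c ℤ.- (ℤ.- b) ℤ.* (ℤ.- d)
  re-conj = ℤ-Solver.solve-∀
  im-conj : ∀ a b c d → ℤ.- (a ℤ.* d ℤ.+ b ℤ.* c) ≡ a ℤ.* (ℤ.- d) ℤ.+ (ℤ.- b) ℤ.* c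
  im-conj = ℤ-Solver.solve-∀

i·_ : Unit → Unit
i· u1  = ui
i· ui  = u-1
i· u-1 = u-i
i· u-i = u1

_⁻¹ : Unit → Unit
u1 ⁻¹  = u1
u-1 ⁻¹ = u-1
ui ⁻¹  = u-i
u-i ⁻¹ = ui

i·-toℤ[i] : ∀ u → toℤ[i] (i· u) ≡ toℤ[i] ui *ᵍ toℤ[i] u
i·-toℤ[i] u1  = refl
i·-toℤ[i] ui  = refl
i·-toℤ[i] u-1 = refl
i·-toℤ[i] u-i = refl

⁻¹-toℤ[i] : ∀ u → toℤ[i] (u ⁻¹) ≡ conj (toℤ[i] u)
⁻¹-toℤ[i] u1  = refl
⁻¹-toℤ[i] ui  = refl
⁻¹-toℤ[i] u-1 = refl
⁻¹-toℤ[i] u-i = refl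

⁻¹-*-cancel : ∀ u z → toℤ[i] (u ⁻¹) *ᵍ (toℤ[i] u *ᵍ z) ≡ z
⁻¹-*-cancel u z = begin
  toℤ[i] (u ⁻¹) *ᵍ (toℤ[i] u *ᵍ z)   ≡⟨ *ᵍ-assoc (toℤ[i] (u ⁻¹)) (toℤ[i] u) z ⟨
  (toℤ[i] (u ⁻¹) *ᵍ toℤ[i] u) *ᵍ z   ≡⟨ cong (_*ᵍ z) (⁻¹-inverse u) ⟩
  1ᵍ *ᵍ z                             ≡⟨ *ᵍ-identityˡ z ⟩
  z                                   ∎
  where
  open ≡-Reasoning
  ⁻¹-inverse : ∀ u → toℤ[i] (u ⁻¹) *ᵍ toℤ[i] u ≡ 1ᵍ
  ⁻¹-inverse u1  = refl
  ⁻¹-inverse ui  = refl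
  ⁻¹-inverse u-1 = refl
  ⁻¹-inverse u-i = refl

unit-induction : (P : ℤ[i] → Set) → (∀ {z} → P z → P (toℤ[i] ui *ᵍ z)) →
                 ∀ u {z} → P z → P (toℤ[i] u *ᵍ z)
unit-induction P step u1  {z} p = subst P (sym (*ᵍ-identityˡ z)) p
unit-induction P step ui      p = step p
unit-induction P step u-1 {z} p = subst P (i² z) (step (step p))
  where
  i² : ∀ z → toℤ[i] ui *ᵍ (toℤ[i] ui *ᵍ z) ≡ toℤ[i] u-1 *ᵍ z
  i² = solve-∀ ℤ[i]-ring
unit-induction P step u-i {z} p = subst P (i³ z) (step (step (step p)))
  where
  i³ : ∀ z → toℤ[i] ui *ᵍ (toℤ[i] ui *ᵍ (toℤ[i] ui *ᵍ z)) ≡ toℤ[i] u-i *ᵍ z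
  i³ = solve-∀ ℤ[i]-ring

mirror : Bool → ℤ[i] → ℤ[i]
mirror false z = z
mirror true  z = conj z

mirror-involutive : ∀ s z → mirror s (mirror s z) ≡ z
mirror-involutive false z         = refl
mirror-involutive true  (x + y i) = cong₂ _+_i refl (ℤₚ.neg-involutive y)

mirror-sub : ∀ s u v → mirror s (u -ᵍ v) ≡ mirror s u -ᵍ mirror s v
mirror-sub false u v                 = refl
mirror-sub true  (a + b i) (c + d i) = cong₂ _+_i refl (ℤₚ.neg-distrib-+ b (ℤ.- d))

σ : Unit → Bool → ℤ[i] → ℤ[i]
σ u s z = toℤ[i] u *ᵍ mirror s z

σ-inverse : ∀ u s {z w} → mirror s (toℤ[i] u *ᵍ z) ≡ w → z ≡ σ (u ⁻¹) s w
σ-inverse u s {z} refl = begin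
  z                                             ≡⟨ ⁻¹-*-cancel u z ⟨
  toℤ[i] (u ⁻¹) *ᵍ (toℤ[i] u *ᵍ z)              ≡⟨ cong (toℤ[i] (u ⁻¹) *ᵍ_) (mirror-involutive s _) ⟨
  σ (u ⁻¹) s (mirror s (toℤ[i] u *ᵍ z))       ∎
  where open ≡-Reasoning

ℓ1 : ℤ[i] → ℕ
ℓ1 (x + y i) = ∣ x ∣ + ∣ y ∣

i*ᵍ : ∀ x y → toℤ[i] ui *ᵍ (x + y i) ≡ (ℤ.- y) + x i
i*ᵍ x y = cong₂ _+_i (re-part x y) (im-part x y)
  where
  re-part : ∀ x y → + 0 ℤ.* x ℤ.- + 1 ℤ.* y ≡ ℤ.- y
  re-part = ℤ-Solver.solve-∀
  im-part : ∀ x y → + 0 ℤ.* y ℤ.+ + 1 ℤ.* x ≡ x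
  im-part = ℤ-Solver.solve-∀

-i*ᵍ : ∀ x y → toℤ[i] u-i *ᵍ (x + y i) ≡ y + (ℤ.- x) i
-i*ᵍ x y = cong₂ _+_i (re-part x y) (im-part x y)
  where
  re-part : ∀ x y → + 0 ℤ.* x ℤ.- (ℤ.- (+ 1)) ℤ.* y ≡ y
  re-part = ℤ-Solver.solve-∀
  im-part : ∀ x y → + 0 ℤ.* y ℤ.+ (ℤ.- (+ 1)) ℤ.* x ≡ ℤ.- x
  im-part = ℤ-Solver.solve-∀

ℓ∞-i : ∀ z → ℓ∞ (toℤ[i] ui *ᵍ z) ≡ ℓ∞ z
ℓ∞-i (x + y i) = begin
  ℓ∞ (toℤ[i] ui *ᵍ (x + y i)) ≡⟨ cong ℓ∞ (i*ᵍ x y) ⟩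
  ∣ ℤ.- y ∣ ⊔ ∣ x ∣           ≡⟨ cong (_⊔ ∣ x ∣) (ℤₚ.∣-i∣≡∣i∣ y) ⟩
  ∣ y ∣ ⊔ ∣ x ∣               ≡⟨ ℕₚ.⊔-comm ∣ y ∣ ∣ x ∣ ⟩
  ∣ x ∣ ⊔ ∣ y ∣               ∎
  where open ≡-Reasoning

ℓ1-i : ∀ z → ℓ1 (toℤ[i] ui *ᵍ z) ≡ ℓ1 z
ℓ1-i (x + y i) = begin
  ℓ1 (toℤ[i] ui *ᵍ (x + y i)) ≡⟨ cong ℓ1 (i*ᵍ x y) ⟩
  ∣ ℤ.- y ∣ + ∣ x ∣           ≡⟨ cong (_+ ∣ x ∣) (ℤₚ.∣-i∣≡∣i∣ y) ⟩
  ∣ y ∣ + ∣ x ∣               ≡⟨ ℕₚ.+-comm ∣ y ∣ ∣ x ∣ ⟩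
  ∣ x ∣ + ∣ y ∣               ∎
  where open ≡-Reasoning

ℓ∞-unit : ∀ u z → ℓ∞ (toℤ[i] u *ᵍ z) ≡ ℓ∞ z
ℓ∞-unit u z = unit-induction (λ w → ℓ∞ w ≡ ℓ∞ z) (λ {w} → trans (ℓ∞-i w)) u refl

ℓ1-unit : ∀ u z → ℓ1 (toℤ[i] u *ᵍ z) ≡ ℓ1 z
ℓ1-unit u z = unit-induction (λ w → ℓ1 w ≡ ℓ1 z) (λ {w} → trans (ℓ1-i w)) u refl

ℓ∞-mirror : ∀ s z → ℓ∞ (mirror s z) ≡ ℓ∞ z
ℓ∞-mirror false z         = refl
ℓ∞-mirror true  (x + y i) = cong (∣ x ∣ ⊔_) (ℤₚ.∣-i∣≡∣i∣ y)

ℓ1-mirror : ∀ s z → ℓ1 (mirror s z) ≡ ℓ1 z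
ℓ1-mirror false z         = refl
ℓ1-mirror true  (x + y i) = cong (_+_ ∣ x ∣) (ℤₚ.∣-i∣≡∣i∣ y)

ℓ∞-σ : ∀ u s z → ℓ∞ (σ u s z) ≡ ℓ∞ z
ℓ∞-σ u s z = trans (ℓ∞-unit u (mirror s z)) (ℓ∞-mirror s z)

ℓ1-σ : ∀ u s z → ℓ1 (σ u s z) ≡ ℓ1 z
ℓ1-σ u s z = trans (ℓ1-unit u (mirror s z)) (ℓ1-mirror s z)

ℓ∞≤ℓ1 : ∀ z → ℓ∞ z ≤ ℓ1 z
ℓ∞≤ℓ1 (x + y i) = ℕₚ.m⊔n≤m+n ∣ x ∣ ∣ y ∣

ℓ∞≡0⇒≡0ᵍ : ∀ z → ℓ∞ z ≡ 0 → z ≡ 0ᵍ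
ℓ∞≡0⇒≡0ᵍ (x + y i) ℓ∞≡0 = cong₂ _+_i (vanishes (ℕₚ.m≤m⊔n ∣ x ∣ ∣ y ∣)) (vanishes (ℕₚ.m≤n⊔m ∣ x ∣ ∣ y ∣))
  where
  vanishes : ∀ {c} → ∣ c ∣ ≤ ∣ x ∣ ⊔ ∣ y ∣ → c ≡ + 0
  vanishes ∣c∣≤ = ℤₚ.∣i∣≡0⇒i≡0 (ℕₚ.n≤0⇒n≡0 (subst (_ ≤_) ℓ∞≡0 ∣c∣≤))

scaleᵍ : ∀ c x y → (c + (+ 0) i) *ᵍ (x + y i) ≡ (c ℤ.* x) + (c ℤ.* y) i
scaleᵍ c x y = cong₂ _+_i (re-part c x y) (im-part c x y)
  where
  re-part : ∀ c x y → c ℤ.* x ℤ.- + 0 ℤ.* y ≡ c ℤ.* x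
  re-part = ℤ-Solver.solve-∀
  im-part : ∀ c x y → c ℤ.* y ℤ.+ + 0 ℤ.* x ≡ c ℤ.* y
  im-part = ℤ-Solver.solve-∀

ℓ∞-scale : ∀ n z → ℓ∞ (((+ n) + (+ 0) i) *ᵍ z) ≡ n * ℓ∞ z
ℓ∞-scale n (x + y i) = begin
  ℓ∞ (((+ n) + (+ 0) i) *ᵍ (x + y i)) ≡⟨ cong ℓ∞ (scaleᵍ (+ n) x y) ⟩
  ∣ + n ℤ.* x ∣ ⊔ ∣ + n ℤ.* y ∣       ≡⟨ cong₂ _⊔_ (ℤₚ.∣i*j∣≡∣i∣*∣j∣ (+ n) x) (ℤₚ.∣i*j∣≡∣i∣*∣j∣ (+ n) y) ⟩
  n * ∣ x ∣ ⊔ n * ∣ y ∣               ≡⟨ ℕₚ.*-distribˡ-⊔ n ∣ x ∣ ∣ y ∣ ⟨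
  n * (∣ x ∣ ⊔ ∣ y ∣)                 ∎
  where open ≡-Reasoning

ℓ1-scale : ∀ n z → ℓ1 (((+ n) + (+ 0) i) *ᵍ z) ≡ n * ℓ1 z
ℓ1-scale n (x + y i) = begin
  ℓ1 (((+ n) + (+ 0) i) *ᵍ (x + y i)) ≡⟨ cong ℓ1 (scaleᵍ (+ n) x y) ⟩
  ∣ + n ℤ.* x ∣ + ∣ + n ℤ.* y ∣       ≡⟨ cong₂ _+_ (ℤₚ.∣i*j∣≡∣i∣*∣j∣ (+ n) x) (ℤₚ.∣i*j∣≡∣i∣*∣j∣ (+ n) y) ⟩
  n * ∣ x ∣ + n * ∣ y ∣               ≡⟨ ℕₚ.*-distribˡ-+ n ∣ x ∣ ∣ y ∣ ⟨
  n * (∣ x ∣ + ∣ y ∣)                 ∎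
  where open ≡-Reasoning

∣i+j∣-or-∣i-j∣ : ∀ a b → ∣ a ℤ.+ b ∣ ≡ ∣ a ∣ + ∣ b ∣ ⊎ ∣ a ℤ.- b ∣ ≡ ∣ a ∣ + ∣ b ∣
∣i+j∣-or-∣i-j∣ (+ m)    (+ n)    = inj₁ refl
∣i+j∣-or-∣i-j∣ (+ m)    -[1+ n ] = inj₂ refl
∣i+j∣-or-∣i-j∣ -[1+ m ] (+ n)    = inj₂ (trans (ℤₚ.∣i-j∣≡∣j-i∣ -[1+ m ] (+ n)) (ℕₚ.+-comm n (suc m)))
∣i+j∣-or-∣i-j∣ -[1+ m ] -[1+ n ] = inj₁ (cong suc (sym (ℕₚ.+-suc m n)))

∣i-j∣⊔∣i+j∣ : ∀ a b → ∣ a ℤ.- b ∣ ⊔ ∣ a ℤ.+ b ∣ ≡ ∣ a ∣ + ∣ b ∣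
∣i-j∣⊔∣i+j∣ a b with ∣i+j∣-or-∣i-j∣ a b
... | inj₁ ∣a+b∣≡ = trans (cong (∣ a ℤ.- b ∣ ⊔_) ∣a+b∣≡) (ℕₚ.m≤n⇒m⊔n≡n (ℤₚ.∣i-j∣≤∣i∣+∣j∣ a b))
... | inj₂ ∣a-b∣≡ = trans (cong (_⊔ ∣ a ℤ.+ b ∣) ∣a-b∣≡) (ℕₚ.m≥n⇒m⊔n≡m (ℤₚ.∣i+j∣≤∣i∣+∣j∣ a b))

ℓ∞-1+i : ∀ w → ℓ∞ (1+i *ᵍ w) ≡ ℓ1 w
ℓ∞-1+i (a + b i) = trans (cong ℓ∞ 1+i*ᵍ) (∣i-j∣⊔∣i+j∣ a b)
  where
  re-part : ∀ a b → + 1 ℤ.* a ℤ.- + 1 ℤ.* b ≡ a ℤ.- b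
  re-part = ℤ-Solver.solve-∀
  im-part : ∀ a b → + 1 ℤ.* b ℤ.+ + 1 ℤ.* a ≡ a ℤ.+ b
  im-part = ℤ-Solver.solve-∀
  1+i*ᵍ : 1+i *ᵍ (a + b i) ≡ (a ℤ.- b) + (a ℤ.+ b) i
  1+i*ᵍ = cong₂ _+_i (re-part a b) (im-part a b)

ℓ1-1+i : ∀ w → ℓ1 (1+i *ᵍ w) ≡ ℓ∞ w + ℓ∞ w
ℓ1-1+i w = begin
  ℓ1 (1+i *ᵍ w)                                  ≡⟨ ℓ∞-1+i (1+i *ᵍ w) ⟨
  ℓ∞ (1+i *ᵍ (1+i *ᵍ w))                         ≡⟨ cong ℓ∞ ([1+i]²≡2i w) ⟩
  ℓ∞ (toℤ[i] ui *ᵍ (((+ 2) + (+ 0) i) *ᵍ w))     ≡⟨ ℓ∞-i (((+ 2) + (+ 0) i) *ᵍ w) ⟩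
  ℓ∞ (((+ 2) + (+ 0) i) *ᵍ w)                    ≡⟨ ℓ∞-scale 2 w ⟩
  ℓ∞ w + (ℓ∞ w + 0)                              ≡⟨ cong (_+_ (ℓ∞ w)) (ℕₚ.+-identityʳ (ℓ∞ w)) ⟩
  ℓ∞ w + ℓ∞ w                                    ∎
  where
  open ≡-Reasoning
  [1+i]²≡2i : ∀ w → 1+i *ᵍ (1+i *ᵍ w) ≡ toℤ[i] ui *ᵍ (((+ 2) + (+ 0) i) *ᵍ w)
  [1+i]²≡2i = solve-∀ ℤ[i]-ring

ℓ∞-+ : ∀ u v → ℓ∞ (u +ᵍ v) ≤ ℓ∞ u + ℓ∞ v
ℓ∞-+ (a + b i) (c + d i) = ℕₚ.⊔-lub
  (ℕₚ.≤-trans (ℤₚ.∣i+j∣≤∣i∣+∣j∣ a c) (ℕₚ.+-mono-≤ (ℕₚ.m≤m⊔n ∣ a ∣ ∣ b ∣) (ℕₚ.m≤m⊔n ∣ c ∣ ∣ d ∣)))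
  (ℕₚ.≤-trans (ℤₚ.∣i+j∣≤∣i∣+∣j∣ b d) (ℕₚ.+-mono-≤ (ℕₚ.m≤n⊔m ∣ a ∣ ∣ b ∣) (ℕₚ.m≤n⊔m ∣ c ∣ ∣ d ∣)))

ℓ1-+ : ∀ u v → ℓ1 (u +ᵍ v) ≤ ℓ1 u + ℓ1 v
ℓ1-+ (a + b i) (c + d i) = begin
  ∣ a ℤ.+ c ∣ + ∣ b ℤ.+ d ∣       ≤⟨ ℕₚ.+-mono-≤ (ℤₚ.∣i+j∣≤∣i∣+∣j∣ a c) (ℤₚ.∣i+j∣≤∣i∣+∣j∣ b d) ⟩
  (∣ a ∣ + ∣ c ∣) + (∣ b ∣ + ∣ d ∣) ≡⟨ +-interchange (∣ a ∣) (∣ c ∣) (∣ b ∣) (∣ d ∣) ⟩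
  (∣ a ∣ + ∣ b ∣) + (∣ c ∣ + ∣ d ∣) ∎
  where open ℕₚ.≤-Reasoning

ℓ∞-*-≤ : ∀ u v → ℓ∞ (u *ᵍ v) ≤ ℓ∞ u * ℓ1 v
ℓ∞-*-≤ (a + b i) (c + d i) = ℕₚ.⊔-lub
  (ℕₚ.≤-trans (ℤₚ.∣i-j∣≤∣i∣+∣j∣ (a ℤ.* c) (b ℤ.* d)) (products c d))
  (ℕₚ.≤-trans (ℤₚ.∣i+j∣≤∣i∣+∣j∣ (a ℤ.* d) (b ℤ.* c))
    (ℕₚ.≤-trans (products d c) (ℕₚ.≤-reflexive (cong (M *_) (ℕₚ.+-comm (∣ d ∣) (∣ c ∣))))))
  where
  open ℕₚ.≤-Reasoning
  M = ∣ a ∣ ⊔ ∣ b ∣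
  products : ∀ p q → ∣ a ℤ.* p ∣ + ∣ b ℤ.* q ∣ ≤ M * (∣ p ∣ + ∣ q ∣)
  products p q = begin
    ∣ a ℤ.* p ∣ + ∣ b ℤ.* q ∣   ≡⟨ cong₂ _+_ (ℤₚ.∣i*j∣≡∣i∣*∣j∣ a p) (ℤₚ.∣i*j∣≡∣i∣*∣j∣ b q) ⟩
    ∣ a ∣ * ∣ p ∣ + ∣ b ∣ * ∣ q ∣ ≤⟨ ℕₚ.+-mono-≤ (ℕₚ.*-monoˡ-≤ ∣ p ∣ (ℕₚ.m≤m⊔n ∣ a ∣ ∣ b ∣))
                                               (ℕₚ.*-monoˡ-≤ ∣ q ∣ (ℕₚ.m≤n⊔m ∣ a ∣ ∣ b ∣)) ⟩
    M * ∣ p ∣ + M * ∣ q ∣       ≡⟨ ℕₚ.*-distribˡ-+ M ∣ p ∣ ∣ q ∣ ⟨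
    M * (∣ p ∣ + ∣ q ∣)         ∎

Digits : ℕ → ℤ[i] → Set
Digits k z = Σ (Vec Digit k) λ ds → evalDigits ds ≡ z

-- The paper's B_n = {0} ∪ {z : φ(z) ≤ n}.
B : ℕ → ℤ[i] → Set
B n = Digits (suc n)

Digits-step : ∀ {k w a} d → digitVal d ≡ a → Digits k w → Digits (suc k) (a +ᵍ 1+i *ᵍ w)
Digits-step d refl (ds , refl) = d ∷ ds , refl

Digits-0 : ∀ k → Digits k 0ᵍ
Digits-0 zero    = [] , refl
Digits-0 (suc k) = Digits-step d0 refl (Digits-0 k)

Digits-1+i : ∀ {k w} → Digits k w → Digits (suc k) (1+i *ᵍ w)
Digits-1+i {w = w} p = subst (Digits _) (+ᵍ-identityˡ (1+i *ᵍ w)) (Digits-step d0 refl p)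

*ᵍ-digit-step : ∀ c a w → c *ᵍ a +ᵍ 1+i *ᵍ (c *ᵍ w) ≡ c *ᵍ (a +ᵍ 1+i *ᵍ w)
*ᵍ-digit-step = solve-∀ ℤ[i]-ring

conj-digit-step : ∀ a w → conj a +ᵍ 1+i *ᵍ (toℤ[i] u-i *ᵍ conj w) ≡ conj (a +ᵍ 1+i *ᵍ w)
conj-digit-step a w = begin
  conj a +ᵍ 1+i *ᵍ (toℤ[i] u-i *ᵍ conj w)   ≡⟨ ring (conj a) (conj w) ⟩
  conj a +ᵍ conj 1+i *ᵍ conj w              ≡⟨ cong (conj a +ᵍ_) (conj-*ᵍ 1+i w) ⟨
  conj a +ᵍ conj (1+i *ᵍ w)                 ≡⟨ conj-+ᵍ a (1+i *ᵍ w) ⟨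
  conj (a +ᵍ 1+i *ᵍ w)                      ∎
  where
  open ≡-Reasoning
  ring : ∀ A W → A +ᵍ 1+i *ᵍ (toℤ[i] u-i *ᵍ W) ≡ A +ᵍ conj 1+i *ᵍ W
  ring = solve-∀ ℤ[i]-ring

i·ᵈ : Digit → Digit
i·ᵈ d0     = d0
i·ᵈ (du u) = du (i· u)

conjᵈ : Digit → Digit
conjᵈ d0     = d0
conjᵈ (du u) = du (u ⁻¹)

Digits-i : ∀ {k z} → Digits k z → Digits k (toℤ[i] ui *ᵍ z)
Digits-i ([] , refl) = [] , refl
Digits-i (d ∷ ds , refl) =
  subst (Digits _) (*ᵍ-digit-step (toℤ[i] ui) (digitVal d) (evalDigits ds))
    (Digits-step (i·ᵈ d) (i·ᵈ-digitVal d) (Digits-i (ds , refl)))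
  where
  i·ᵈ-digitVal : ∀ d → digitVal (i·ᵈ d) ≡ toℤ[i] ui *ᵍ digitVal d
  i·ᵈ-digitVal d0     = refl
  i·ᵈ-digitVal (du u) = i·-toℤ[i] u

Digits-unit : ∀ u {k z} → Digits k z → Digits k (toℤ[i] u *ᵍ z)
Digits-unit u = unit-induction (Digits _) Digits-i u

Digits-conj : ∀ {k z} → Digits k z → Digits k (conj z)
Digits-conj ([] , refl) = [] , refl
Digits-conj (d ∷ ds , refl) =
  subst (Digits _) (conj-digit-step (digitVal d) (evalDigits ds))
    (Digits-step (conjᵈ d) (conjᵈ-digitVal d) (Digits-unit u-i (Digits-conj (ds , refl))))
  where
  conjᵈ-digitVal : ∀ d → digitVal (conjᵈ d) ≡ conj (digitVal d)
  conjᵈ-digitVal d0     = refl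
  conjᵈ-digitVal (du u) = ⁻¹-toℤ[i] u

Digits-mirror : ∀ s {k z} → Digits k z → Digits k (mirror s z)
Digits-mirror false p = p
Digits-mirror true  p = Digits-conj p

Digits-σ : ∀ u s {k z} → Digits k z → Digits k (σ u s z)
Digits-σ u s p = Digits-unit u (Digits-mirror s p)

Odd : ℕ → Set
Odd n = ∃ λ k → n ≡ suc (k + k)

data ParityView : ℕ → Set where
  even : ∀ k → ParityView (k + k)
  odd  : ∀ k → ParityView (suc (k + k))

parityView : ∀ n → ParityView n
parityView zero = even 0
parityView (suc n) with parityView n
... | even k = odd k
... | odd k  = subst ParityView (cong suc (ℕₚ.+-suc k k)) (even (suc k))

even≢odd : ∀ m n → m + m ≢ suc (n + n)
even≢odd (suc m) zero    eq with () ← trans (sym (ℕₚ.+-suc m m)) (ℕₚ.suc-injective eq)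
even≢odd (suc m) (suc n) eq = even≢odd m n (ℕₚ.suc-injective (begin
  suc (m + m)       ≡⟨ ℕₚ.+-suc m m ⟨
  m + suc m         ≡⟨ ℕₚ.suc-injective eq ⟩
  suc (n + suc n)   ≡⟨ cong suc (ℕₚ.+-suc n n) ⟩
  suc (suc (n + n)) ∎))
  where open ≡-Reasoning

half-≤ : ∀ {m n} → m + m ≤ suc (n + n) → m ≤ n
half-≤ {m} {n} m+m≤ = ℕₚ.≮⇒≥ λ n<m → ℕₚ.<-irrefl refl (begin-strict
  suc (n + n)       <⟨ ℕₚ.n<1+n _ ⟩
  suc (suc (n + n)) ≡⟨ cong suc (ℕₚ.+-suc n n) ⟨
  suc n + suc n     ≤⟨ ℕₚ.+-mono-≤ n<m n<m ⟩
  m + m             ≤⟨ m+m≤ ⟩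
  suc (n + n)       ∎)
  where open ℕₚ.≤-Reasoning

odd-≤-pred : ∀ {m k} → Odd m → m ≤ suc (suc (k + k)) → m ≤ suc (k + k)
odd-≤-pred {m} {k} (t , refl) m≤ with ℕₚ.m≤n⇒m<n∨m≡n m≤
... | inj₁ m<   = ℕₚ.≤-pred m<
... | inj₂ m≡ = ⊥-elim (even≢odd (suc k) t (sym (trans m≡ (cong suc (sym (ℕₚ.+-suc k k))))))

1+i∣_ : ℤ[i] → Set
1+i∣ z = ∃ λ w → z ≡ 1+i *ᵍ w

1+i∣-σ : ∀ u s {z} → 1+i∣ z → 1+i∣ σ u s z
1+i∣-σ u false (w , refl) = toℤ[i] u *ᵍ w , commute (toℤ[i] u) w
  where
  commute : ∀ c w → c *ᵍ (1+i *ᵍ w) ≡ 1+i *ᵍ (c *ᵍ w)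
  commute = solve-∀ ℤ[i]-ring
1+i∣-σ u true (w , refl) =
  toℤ[i] u *ᵍ (toℤ[i] u-i *ᵍ conj w) ,
  trans (cong (toℤ[i] u *ᵍ_) (conj-*ᵍ 1+i w)) (commute (toℤ[i] u) (conj w))
  where
  commute : ∀ c W → c *ᵍ (conj 1+i *ᵍ W) ≡ 1+i *ᵍ (c *ᵍ (toℤ[i] u-i *ᵍ W))
  commute = solve-∀ ℤ[i]-ring

1+i*-distrib-sub : ∀ w w′ → 1+i *ᵍ w +ᵍ negᵍ (1+i *ᵍ w′) ≡ 1+i *ᵍ (w +ᵍ negᵍ w′)
1+i*-distrib-sub = solve-∀ ℤ[i]-ring

1+i∣-sub : ∀ {u v} → 1+i∣ u → 1+i∣ v → 1+i∣ (u -ᵍ v)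
1+i∣-sub (w , refl) (w′ , refl) = w -ᵍ w′ , 1+i*-distrib-sub w w′

1+i∣⇒¬Odd-ℓ1 : ∀ {z} → 1+i∣ z → ¬ Odd (ℓ1 z)
1+i∣⇒¬Odd-ℓ1 (w , refl) (t , ℓ1≡) = even≢odd (ℓ∞ w) t (trans (sym (ℓ1-1+i w)) ℓ1≡)

ℓ1-unit≡1 : ∀ u → ℓ1 (toℤ[i] u) ≡ 1
ℓ1-unit≡1 u1  = refl
ℓ1-unit≡1 ui  = refl
ℓ1-unit≡1 u-1 = refl
ℓ1-unit≡1 u-i = refl

1+i-injective : ∀ {u v} → 1+i *ᵍ u ≡ 1+i *ᵍ v → u ≡ v
1+i-injective {a + b i} {c + d i} eq =
  cong₂ _+_i (ℤₚ.*-cancelˡ-≡ (+ 2) a c (cong re doubled)) (ℤₚ.*-cancelˡ-≡ (+ 2) b d (cong im doubled))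
  where
  two : ∀ z → ((+ 2) + (+ 0) i) *ᵍ z ≡ conj 1+i *ᵍ (1+i *ᵍ z)
  two = solve-∀ ℤ[i]-ring
  twice : ∀ z → (+ 2 ℤ.* re z) + (+ 2 ℤ.* im z) i ≡ conj 1+i *ᵍ (1+i *ᵍ z)
  twice (x + y i) = trans (sym (scaleᵍ (+ 2) x y)) (two (x + y i))
  doubled : (+ 2 ℤ.* a) + (+ 2 ℤ.* b) i ≡ (+ 2 ℤ.* c) + (+ 2 ℤ.* d) i
  doubled = trans (twice (a + b i)) (trans (cong (conj 1+i *ᵍ_) eq) (sym (twice (c + d i))))

Digits-1+i⁻¹ : ∀ {k w} → Digits (suc k) (1+i *ᵍ w) → Digits k w
Digits-1+i⁻¹ (d0 ∷ ds , eq) = ds , 1+i-injective (trans (sym (+ᵍ-identityˡ _)) eq)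
Digits-1+i⁻¹ {w = w} (du u ∷ ds , eq) =
  ⊥-elim (1+i∣⇒¬Odd-ℓ1 (w -ᵍ evalDigits ds , unit≡ (toℤ[i] u) (evalDigits ds) w eq) (0 , ℓ1-unit≡1 u))
  where
  unit≡ : ∀ a v w → a +ᵍ 1+i *ᵍ v ≡ 1+i *ᵍ w → a ≡ 1+i *ᵍ (w -ᵍ v)
  unit≡ a v w eq = begin
    a                                        ≡⟨ cancel a v ⟩
    (a +ᵍ 1+i *ᵍ v) -ᵍ 1+i *ᵍ v              ≡⟨ cong (_-ᵍ 1+i *ᵍ v) eq ⟩
    1+i *ᵍ w -ᵍ 1+i *ᵍ v                     ≡⟨ 1+i*-distrib-sub w v ⟩
    1+i *ᵍ (w -ᵍ v)                          ∎
    where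
    open ≡-Reasoning
    cancel : ∀ a v → a ≡ (a +ᵍ 1+i *ᵍ v) +ᵍ negᵍ (1+i *ᵍ v)
    cancel = solve-∀ ℤ[i]-ring

pt : ℕ → ℕ → ℤ[i]
pt x y = (+ x) + (+ y) i

data OctantView : ℕ → ℕ → Set where
  even : ∀ y d → OctantView (y + (d + d)) y
  odd  : ∀ y d → OctantView (y + suc (d + d)) y

octantView : ∀ {x y} → y ≤ x → OctantView x y
octantView y≤x with ℕₚ.m≤n⇒∃[o]m+o≡n y≤x
... | e , refl with parityView e
...   | even d = even _ d
...   | odd d  = odd _ d

pt-halve : ∀ y d → pt (y + (d + d)) y ≡ 1+i *ᵍ conj (pt (y + d) d)
pt-halve y d = halve (+ y) (+ d)
  where
  halve : ∀ y d → (y ℤ.+ (d ℤ.+ d)) + y i ≡ 1+i *ᵍ conj ((y ℤ.+ d) + d i)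
  halve y d = cong₂ _+_i (re-part y d) (im-part y d)
    where
    re-part : ∀ y d → y ℤ.+ (d ℤ.+ d) ≡ + 1 ℤ.* (y ℤ.+ d) ℤ.- + 1 ℤ.* (ℤ.- d)
    re-part = ℤ-Solver.solve-∀
    im-part : ∀ y d → y ≡ + 1 ℤ.* (ℤ.- d) ℤ.+ + 1 ℤ.* (y ℤ.+ d)
    im-part = ℤ-Solver.solve-∀

pt-halve-1+i∣ : ∀ y d → 1+i∣ pt (y + (d + d)) y
pt-halve-1+i∣ y d = conj (pt (y + d) d) , pt-halve y d

B-halve : ∀ {k} y d → B (suc k) (pt (y + (d + d)) y) → B k (pt (y + d) d)
B-halve y d p = subst (B _) (mirror-involutive true (pt (y + d) d))
  (Digits-conj (Digits-1+i⁻¹ (subst (B _) (pt-halve y d) p)))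

B-unhalve : ∀ {k} y d → B k (pt (y + d) d) → B (suc k) (pt (y + (d + d)) y)
B-unhalve y d p = subst (B _) (sym (pt-halve y d)) (Digits-1+i (Digits-conj p))

unit+B-unhalve : ∀ {k} u y d → B k (pt (y + d) d) → B (suc k) (toℤ[i] u +ᵍ pt (y + (d + d)) y)
unit+B-unhalve u y d p =
  subst (B _) (cong (toℤ[i] u +ᵍ_) (sym (pt-halve y d))) (Digits-step (du u) refl (Digits-conj p))

octant-odd : ∀ y d → Odd ((y + suc (d + d)) + y)
octant-odd y d = y + d , doubled y d
  where
  doubled : ∀ y d → (y + suc (d + d)) + y ≡ suc ((y + d) + (y + d))
  doubled = ℕ-Solver.solve-∀

octant-halves : ∀ y d → (y + (d + d)) + y ≡ (y + d) + (y + d)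
octant-halves = ℕ-Solver.solve-∀

∣m⊖n∣≡∣m-n∣ : ∀ m n → ∣ m ℤ.⊖ n ∣ ≡ ∣ m - n ∣
∣m⊖n∣≡∣m-n∣ m n with ℕₚ.≤-total m n
... | inj₁ m≤n = trans (ℤₚ.∣⊖∣-≤ m≤n) (sym (ℕₚ.m≤n⇒∣m-n∣≡n∸m m≤n))
... | inj₂ n≤m = trans (ℤₚ.∣m⊖n∣≡∣n⊖m∣ m n) (trans (ℤₚ.∣⊖∣-≤ n≤m) (sym (ℕₚ.m≤n⇒∣n-m∣≡n∸m n≤m)))

∣+m-+n∣≡∣m-n∣ : ∀ m n → ∣ + m ℤ.- + n ∣ ≡ ∣ m - n ∣
∣+m-+n∣≡∣m-n∣ m n = trans (cong ∣_∣ (ℤₚ.[+m]-[+n]≡m⊖n m n)) (∣m⊖n∣≡∣m-n∣ m n)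

ℓ∞-pt-sub : ∀ a b c d → ℓ∞ (pt a b -ᵍ pt c d) ≡ ∣ a - c ∣ ⊔ ∣ b - d ∣
ℓ∞-pt-sub a b c d = cong₂ _⊔_ (∣+m-+n∣≡∣m-n∣ a c) (∣+m-+n∣≡∣m-n∣ b d)

ℓ1-pt-sub : ∀ a b c d → ℓ1 (pt a b -ᵍ pt c d) ≡ ∣ a - c ∣ + ∣ b - d ∣
ℓ1-pt-sub a b c d = cong₂ _+_ (∣+m-+n∣≡∣m-n∣ a c) (∣+m-+n∣≡∣m-n∣ b d)

record OctantForm (z : ℤ[i]) : Set where
  constructor octant
  field
    x y : ℕ
    y≤x : y ≤ x
    u   : Unit
    s   : Bool
    z≡  : z ≡ σ u s (pt x y)

toQuadrant : ∀ z → ∃ λ u → ∃ λ a → ∃ λ b → z ≡ toℤ[i] u *ᵍ pt a b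
toQuadrant ((+ a) + (+ b) i)       = u1 , a , b , sym (*ᵍ-identityˡ (pt a b))
toQuadrant (-[1+ a ] + (+ b) i)    = ui , b , suc a , sym (i*ᵍ (+ b) (+ suc a))
toQuadrant (-[1+ a ] + -[1+ b ] i) = u-1 , suc a , suc b , sym (−1*ᵍ (pt (suc a) (suc b)))
  where
  −1*ᵍ : ∀ w → toℤ[i] u-1 *ᵍ w ≡ negᵍ w
  −1*ᵍ = solve-∀ ℤ[i]-ring
toQuadrant ((+ a) + -[1+ b ] i)    = u-i , suc b , a , sym (-i*ᵍ (+ suc b) (+ a))

toOctant : ∀ z → OctantForm z
toOctant z with toQuadrant z
... | u , a , b , z≡ with ℕₚ.≤-total b a
...   | inj₁ b≤a = octant a b b≤a u false z≡
...   | inj₂ a≤b = octant b a a≤b (i· u) true (trans z≡ (reflect-diagonal u a b))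
  where
  reflect-diagonal : ∀ u a b → toℤ[i] u *ᵍ pt a b ≡ σ (i· u) true (pt b a)
  reflect-diagonal u a b =
    trans (swap (toℤ[i] u) (+ a) (+ b)) (cong (_*ᵍ conj (pt b a)) (sym (i·-toℤ[i] u)))
    where
    rotate : ∀ c w → c *ᵍ w ≡ (toℤ[i] ui *ᵍ c) *ᵍ (toℤ[i] u-i *ᵍ w)
    rotate = solve-∀ ℤ[i]-ring
    swap : ∀ c x y → c *ᵍ (x + y i) ≡ (toℤ[i] ui *ᵍ c) *ᵍ conj (y + x i)
    swap c x y = trans (rotate c (x + y i)) (cong ((toℤ[i] ui *ᵍ c) *ᵍ_) (-i*ᵍ x y))

¬1+i∣⇒Odd-ℓ1 : ∀ z → ¬ 1+i∣ z → Odd (ℓ1 z)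
¬1+i∣⇒Odd-ℓ1 z ¬1+i∣z with toOctant z
... | octant x y y≤x u s refl with octantView y≤x
...   | even y d = ⊥-elim (¬1+i∣z (1+i∣-σ u s (pt-halve-1+i∣ y d)))
...   | odd y d  = subst Odd (sym (ℓ1-σ u s (pt _ y))) (octant-odd y d)

-- B n lies in the octagon ℓ∞ ≤ L n, ℓ1 ≤ S n and contains all its odd
-- points; it also contains the square ℓ∞ ≤ Q n and the diamond ℓ1 ≤ 2 P n + 1.
P Q : ℕ → ℕ
P zero    = 0
P (suc n) = Q n
Q zero    = 0
Q (suc n) = suc (P n + P n)

L S : ℕ → ℕ
L n = suc (P n + (P n + Q n))
S n = suc ((P n + Q n) + (P n + Q n))

L-suc : ∀ n → L (suc n) ≡ suc (S n)
L-suc n = cong suc (lemma (P n) (Q n))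
  where
  lemma : ∀ p q → q + (q + suc (p + p)) ≡ suc ((p + q) + (p + q))
  lemma = ℕ-Solver.solve-∀

S-suc : ∀ n → S (suc n) ≡ suc (L n + L n)
S-suc n = cong suc (lemma (P n) (Q n))
  where
  lemma : ∀ p q → (q + suc (p + p)) + (q + suc (p + p)) ≡ suc (p + (p + q)) + suc (p + (p + q))
  lemma = ℕ-Solver.solve-∀

L-suc′ : ∀ n → L (suc n) ≡ L n + suc (Q n)
L-suc′ n = cong suc (lemma (P n) (Q n))
  where
  lemma : ∀ p q → q + (q + suc (p + p)) ≡ (p + (p + q)) + suc q
  lemma = ℕ-Solver.solve-∀

S-suc′ : ∀ n → S (suc n) ≡ S n + suc (suc (P n + P n))
S-suc′ n = cong suc (lemma (P n) (Q n))
  where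
  lemma : ∀ p q → (q + suc (p + p)) + (q + suc (p + p)) ≡ ((p + q) + (p + q)) + suc (suc (p + p))
  lemma = ℕ-Solver.solve-∀

odd-≤-S : ∀ n {m} → Odd m → m ≤ suc (S n) → m ≤ S n
odd-≤-S n = odd-≤-pred {k = P n + Q n}

digit-ℓ1≤1 : ∀ d → ℓ1 (digitVal d) ≤ 1
digit-ℓ1≤1 d0     = z≤n
digit-ℓ1≤1 (du u) = ℕₚ.≤-reflexive (ℓ1-unit≡1 u)

digit-step-ℓ∞ : ∀ d w → ℓ∞ (digitVal d +ᵍ 1+i *ᵍ w) ≤ suc (ℓ1 w)
digit-step-ℓ∞ d w = begin
  ℓ∞ (digitVal d +ᵍ 1+i *ᵍ w)         ≤⟨ ℓ∞-+ (digitVal d) (1+i *ᵍ w) ⟩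
  ℓ∞ (digitVal d) + ℓ∞ (1+i *ᵍ w)     ≤⟨ ℕₚ.+-mono-≤ (ℕₚ.≤-trans (ℓ∞≤ℓ1 (digitVal d)) (digit-ℓ1≤1 d))
                                                    (ℕₚ.≤-reflexive (ℓ∞-1+i w)) ⟩
  1 + ℓ1 w                            ∎
  where open ℕₚ.≤-Reasoning

digit-step-ℓ1 : ∀ d w → ℓ1 (digitVal d +ᵍ 1+i *ᵍ w) ≤ suc (ℓ∞ w + ℓ∞ w)
digit-step-ℓ1 d w = begin
  ℓ1 (digitVal d +ᵍ 1+i *ᵍ w)         ≤⟨ ℓ1-+ (digitVal d) (1+i *ᵍ w) ⟩
  ℓ1 (digitVal d) + ℓ1 (1+i *ᵍ w)     ≤⟨ ℕₚ.+-mono-≤ (digit-ℓ1≤1 d) (ℕₚ.≤-reflexive (ℓ1-1+i w)) ⟩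
  1 + (ℓ∞ w + ℓ∞ w)                   ∎
  where open ℕₚ.≤-Reasoning

B-bounds : ∀ n {z} → B n z → ℓ∞ z ≤ L n × ℓ1 z ≤ S n
B-bounds zero    (d ∷ [] , refl) = digit-step-ℓ∞ d 0ᵍ , digit-step-ℓ1 d 0ᵍ
B-bounds (suc n) (d ∷ ds , refl) with B-bounds n (ds , refl)
... | ℓ∞≤L , ℓ1≤S =
  ℕₚ.≤-trans (digit-step-ℓ∞ d (evalDigits ds))
    (ℕₚ.≤-trans (s≤s ℓ1≤S) (ℕₚ.≤-reflexive (sym (L-suc n)))) ,
  ℕₚ.≤-trans (digit-step-ℓ1 d (evalDigits ds))
    (ℕₚ.≤-trans (s≤s (ℕₚ.+-mono-≤ ℓ∞≤L ℓ∞≤L)) (ℕₚ.≤-reflexive (sym (S-suc n))))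

OddOctagon⊆B : ℕ → Set
OddOctagon⊆B n = ∀ {x y} → y ≤ x → Odd (x + y) → x ≤ L n → x + y ≤ S n → B n (pt x y)

-- pt (y + 2d + 1) y is a unit u plus pt (y₀ + 2d₀) y₀ = (1 + i) conj (pt (y₀ + d₀) d₀),
-- where u is chosen by the parity of y so that pt (y₀ + d₀) d₀ is odd.
odd-octagon-step : ∀ n → OddOctagon⊆B n → ∀ y d → y + (d + d) ≤ S n → y + d ≤ L n →
                   B (suc n) (pt (y + suc (d + d)) y)
odd-octagon-step n odd⊆B y d y+2d≤S y+d≤L with parityView y
... | odd b = subst (B (suc n)) (cong (λ x → pt x y′) (sym (ℕₚ.+-suc y′ (d + d))))
  (unit+B-unhalve u1 y′ d (odd⊆B (ℕₚ.m≤n+m d y′) (b + d , odd-sum b d) y+d≤L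
    (subst (_≤ S n) (sym (ℕₚ.+-assoc y′ d d)) y+2d≤S)))
  where
  y′ = suc (b + b)
  odd-sum : ∀ b d → (suc (b + b) + d) + d ≡ suc ((b + d) + (b + d))
  odd-sum = ℕ-Solver.solve-∀
... | even zero = unit+B-unhalve u-i 1 d (odd⊆B (ℕₚ.n≤1+n d) (d , refl)
    (s≤s (ℕₚ.≤-trans d≤K (ℕₚ.m≤n+m (P n + Q n) (P n)))) (s≤s (ℕₚ.+-mono-≤ d≤K d≤K)))
  where
  d≤K : d ≤ P n + Q n
  d≤K = half-≤ y+2d≤S
... | even (suc b) = subst (B (suc n)) (cong (λ x → pt x (suc y″)) (shift y″ d))
  (unit+B-unhalve ui y″ (suc d) (odd⊆B (ℕₚ.m≤n+m (suc d) y″) odd′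
    (subst (_≤ L n) (sym (ℕₚ.+-suc y″ d)) y+d≤L)
    (odd-≤-S n odd′ (subst (_≤ suc (S n)) (sym (shift′ y″ d)) (s≤s y+2d≤S)))))
  where
  y″ = b + suc b
  shift : ∀ y d → y + (suc d + suc d) ≡ suc y + suc (d + d)
  shift = ℕ-Solver.solve-∀
  shift′ : ∀ y d → (y + suc d) + suc d ≡ suc (suc y + (d + d))
  shift′ = ℕ-Solver.solve-∀
  odd-sum : ∀ b d → ((b + suc b) + suc d) + suc d ≡ suc ((suc b + d) + (suc b + d))
  odd-sum = ℕ-Solver.solve-∀
  odd′ : Odd ((y″ + suc d) + suc d)
  odd′ = suc b + d , odd-sum b d

odd-octant∈B : ∀ n → OddOctagon⊆B n
odd-octant∈B n y≤x (t , x+y≡) x≤L x+y≤S with octantView y≤x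
... | even y d = ⊥-elim (even≢odd (y + d) t (trans (sym (octant-halves y d)) x+y≡))
odd-octant∈B zero _ _ _ _           | odd zero zero = du u1 ∷ [] , refl
odd-octant∈B zero _ _ _ (s≤s ())    | odd zero (suc d)
odd-octant∈B zero _ _ _ (s≤s x+y≤0) | odd (suc y) d
  with () ← ℕₚ.m+n≤o⇒n≤o (y + suc (d + d)) x+y≤0
odd-octant∈B (suc n) _ _ x≤L x+y≤S | odd y d = odd-octagon-step n (odd-octant∈B n) y d
  (ℕₚ.≤-pred (subst₂ _≤_ (ℕₚ.+-suc y (d + d)) (L-suc n) x≤L))
  (half-≤ (ℕₚ.m≤n⇒m≤1+n (ℕₚ.≤-pred (subst₂ _≤_ (doubled y d) (S-suc n) x+y≤S))))
  where
  doubled : ∀ y d → (y + suc (d + d)) + y ≡ suc ((y + d) + (y + d))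
  doubled = ℕ-Solver.solve-∀

odd∈B : ∀ n {z} → Odd (ℓ1 z) → ℓ∞ z ≤ L n → ℓ1 z ≤ S n → B n z
odd∈B n {z} odd-ℓ1 ℓ∞≤L ℓ1≤S with toOctant z
... | octant x y y≤x u s refl = Digits-σ u s
  (odd-octant∈B n y≤x (subst Odd ℓ1≡ odd-ℓ1) (subst (_≤ L n) ℓ∞≡ ℓ∞≤L) (subst (_≤ S n) ℓ1≡ ℓ1≤S))
  where
  ℓ1≡ : ℓ1 (σ u s (pt x y)) ≡ x + y
  ℓ1≡ = ℓ1-σ u s (pt x y)
  ℓ∞≡ : ℓ∞ (σ u s (pt x y)) ≡ x
  ℓ∞≡ = trans (ℓ∞-σ u s (pt x y)) (ℕₚ.m≥n⇒m⊔n≡m y≤x)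

square⊆octagon : ∀ k {x y} → y ≤ x → x ≤ Q k → x ≤ L k × x + y ≤ S k
square⊆octagon k {x} {y} y≤x x≤Q =
  ℕₚ.≤-trans x≤Q (Q≤L (P k) (Q k)) ,
  ℕₚ.≤-trans (ℕₚ.+-mono-≤ x≤Q (ℕₚ.≤-trans y≤x x≤Q)) (2Q≤S (P k) (Q k))
  where
  Q≤L : ∀ p q → q ≤ suc (p + (p + q))
  Q≤L p q = ℕₚ.m≤n⇒m≤1+n (ℕₚ.≤-trans (ℕₚ.m≤n+m q p) (ℕₚ.m≤n+m (p + q) p))
  2Q≤S : ∀ p q → q + q ≤ suc ((p + q) + (p + q))
  2Q≤S p q = ℕₚ.m≤n⇒m≤1+n (ℕₚ.+-mono-≤ (ℕₚ.m≤n+m q p) (ℕₚ.m≤n+m q p))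

diamond⊆octagon : ∀ k {x y} → x + y ≤ suc (P k + P k) → x ≤ L k × x + y ≤ S k
diamond⊆octagon k {x} {y} x+y≤ =
  ℕₚ.≤-trans (ℕₚ.m≤m+n x y) (ℕₚ.≤-trans x+y≤ (s≤s (ℕₚ.+-monoʳ-≤ (P k) (ℕₚ.m≤m+n (P k) (Q k))))) ,
  ℕₚ.≤-trans x+y≤ (s≤s (ℕₚ.+-mono-≤ (ℕₚ.m≤m+n (P k) (Q k)) (ℕₚ.m≤m+n (P k) (Q k))))

square∪diamond⊆B : ∀ k {x y} → y ≤ x → x ≤ Q k ⊎ x + y ≤ suc (P k + P k) → B k (pt x y)
square∪diamond⊆B k y≤x small with octantView y≤x
... | odd y d = odd-octant∈B k y≤x (octant-odd y d) (proj₁ inOctagon) (proj₂ inOctagon)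
  where
  inOctagon : y + suc (d + d) ≤ L k × (y + suc (d + d)) + y ≤ S k
  inOctagon = [ square⊆octagon k y≤x , diamond⊆octagon k ]′ small
square∪diamond⊆B zero y≤x small | even y d = origin y d (y+d≡0 small)
  where
  y+d≡0 : y + (d + d) ≤ 0 ⊎ (y + (d + d)) + y ≤ 1 → y + d ≡ 0
  y+d≡0 (inj₁ x≤0)   = ℕₚ.n≤0⇒n≡0 (ℕₚ.≤-trans (ℕₚ.+-monoʳ-≤ y (ℕₚ.m≤m+n d d)) x≤0)
  y+d≡0 (inj₂ x+y≤1) = ℕₚ.n≤0⇒n≡0 (half-≤ (subst (_≤ 1) (octant-halves y d) x+y≤1))
  origin : ∀ y d → y + d ≡ 0 → B 0 (pt (y + (d + d)) y)
  origin zero    zero    refl = Digits-0 1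
  origin zero    (suc d) ()
  origin (suc y) d       ()
square∪diamond⊆B (suc k) y≤x small | even y d =
  B-unhalve y d (square∪diamond⊆B k (ℕₚ.m≤n+m d y) (swap small))
  where
  swap : y + (d + d) ≤ Q (suc k) ⊎ (y + (d + d)) + y ≤ suc (Q k + Q k) →
         y + d ≤ Q k ⊎ (y + d) + d ≤ suc (P k + P k)
  swap (inj₁ x≤Q)  = inj₂ (subst (_≤ suc (P k + P k)) (sym (ℕₚ.+-assoc y d d)) x≤Q)
  swap (inj₂ x+y≤) = inj₁ (half-≤ (subst (_≤ suc (Q k + Q k)) (octant-halves y d) x+y≤))

-- The last two hypotheses are the Gauss remainder bounds 2 ℓ∞ r ≤ ℓ1 b and
-- ℓ1 r ≤ ℓ∞ b for the octant points r = pt x₁ y₁ and b = pt x₂ y₂.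
module Octant-difference {k x₁ y₁ x₂ y₂ : ℕ} (y₁≤x₁ : y₁ ≤ x₁) (y₂≤x₂ : y₂ ≤ x₂)
  (b∈B : B (suc k) (pt x₂ y₂)) (r∉B : ¬ B k (pt x₁ y₁))
  (2x₁≤x₂+y₂ : x₁ + x₁ ≤ x₂ + y₂) (x₁+y₁≤x₂ : x₁ + y₁ ≤ x₂) where

  x₂≤L : x₂ ≤ L (suc k)
  x₂≤L = ℕₚ.≤-trans (ℕₚ.m≤m⊔n x₂ y₂) (proj₁ (B-bounds (suc k) b∈B))

  x₂+y₂≤S : x₂ + y₂ ≤ suc (L k + L k)
  x₂+y₂≤S = ℕₚ.≤-trans (proj₂ (B-bounds (suc k) b∈B)) (ℕₚ.≤-reflexive (S-suc k))

  x₁≤x₂ : x₁ ≤ x₂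
  x₁≤x₂ = ℕₚ.m+n≤o⇒m≤o x₁ x₁+y₁≤x₂

  x₁≤L : x₁ ≤ L k
  x₁≤L = half-≤ (ℕₚ.≤-trans 2x₁≤x₂+y₂ x₂+y₂≤S)

  y₂≤L : y₂ ≤ L k
  y₂≤L = half-≤ (ℕₚ.≤-trans (ℕₚ.+-monoˡ-≤ y₂ y₂≤x₂) x₂+y₂≤S)

  Q<x₁ : Q k < x₁
  Q<x₁ = ℕₚ.≰⇒> λ x₁≤Q → r∉B (square∪diamond⊆B k y₁≤x₁ (inj₁ x₁≤Q))

  1+2P<x₁+y₁ : suc (P k + P k) < x₁ + y₁
  1+2P<x₁+y₁ = ℕₚ.≰⇒> λ x₁+y₁≤ → r∉B (square∪diamond⊆B k y₁≤x₁ (inj₂ x₁+y₁≤))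

  r-not-odd : ¬ Odd (x₁ + y₁)
  r-not-odd r-odd = r∉B (odd-octant∈B k y₁≤x₁ r-odd x₁≤L
    (odd-≤-S k r-odd (ℕₚ.≤-trans x₁+y₁≤x₂ (ℕₚ.≤-trans x₂≤L (ℕₚ.≤-reflexive (L-suc k))))))

  ℓ∞-difference : ℓ∞ (pt x₁ y₁ -ᵍ pt x₂ y₂) ≤ L k
  ℓ∞-difference = subst (_≤ L k) (sym (ℓ∞-pt-sub x₁ y₁ x₂ y₂)) (ℕₚ.⊔-lub x-gap y-gap)
    where
    open ℕₚ.≤-Reasoning
    x-gap : ∣ x₁ - x₂ ∣ ≤ L k
    x-gap = begin
      ∣ x₁ - x₂ ∣                    ≡⟨ ℕₚ.m≤n⇒∣m-n∣≡n∸m x₁≤x₂ ⟩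
      x₂ ∸ x₁                        ≤⟨ ℕₚ.∸-mono (ℕₚ.≤-trans x₂≤L (ℕₚ.≤-reflexive (L-suc′ k))) Q<x₁ ⟩
      (L k + suc (Q k)) ∸ suc (Q k)  ≡⟨ ℕₚ.m+n∸n≡m (L k) (suc (Q k)) ⟩
      L k                            ∎
    y-gap : ∣ y₁ - y₂ ∣ ≤ L k
    y-gap = ℕₚ.≤-trans (ℕₚ.∣m-n∣≤m⊔n y₁ y₂) (ℕₚ.⊔-lub (ℕₚ.≤-trans y₁≤x₁ x₁≤L) y₂≤L)

  ℓ1-difference : ℓ1 (pt x₁ y₁ -ᵍ pt x₂ y₂) ≤ suc (S k)
  ℓ1-difference = subst (_≤ suc (S k)) (sym (ℓ1-pt-sub x₁ y₁ x₂ y₂)) gaps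
    where
    open ℕₚ.≤-Reasoning
    gaps : ∣ x₁ - x₂ ∣ + ∣ y₁ - y₂ ∣ ≤ suc (S k)
    gaps with ℕₚ.≤-total y₁ y₂
    ... | inj₁ y₁≤y₂ = ℕₚ.m≤n⇒m≤1+n (ℕₚ.+-cancelʳ-≤ (x₁ + y₁) _ _ (begin
      (∣ x₁ - x₂ ∣ + ∣ y₁ - y₂ ∣) + (x₁ + y₁)
        ≡⟨ cong₂ (λ a b → (a + b) + (x₁ + y₁)) (ℕₚ.m≤n⇒∣m-n∣≡n∸m x₁≤x₂) (ℕₚ.m≤n⇒∣m-n∣≡n∸m y₁≤y₂) ⟩
      ((x₂ ∸ x₁) + (y₂ ∸ y₁)) + (x₁ + y₁)
        ≡⟨ +-interchange (x₂ ∸ x₁) (y₂ ∸ y₁) x₁ y₁ ⟩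
      ((x₂ ∸ x₁) + x₁) + ((y₂ ∸ y₁) + y₁)
        ≡⟨ cong₂ _+_ (ℕₚ.m∸n+n≡m x₁≤x₂) (ℕₚ.m∸n+n≡m y₁≤y₂) ⟩
      x₂ + y₂                          ≤⟨ proj₂ (B-bounds (suc k) b∈B) ⟩
      S (suc k)                        ≡⟨ S-suc′ k ⟩
      S k + suc (suc (P k + P k))      ≤⟨ ℕₚ.+-monoʳ-≤ (S k) 1+2P<x₁+y₁ ⟩
      S k + (x₁ + y₁)                  ∎))
    ... | inj₂ y₂≤y₁ = begin
      ∣ x₁ - x₂ ∣ + ∣ y₁ - y₂ ∣
        ≡⟨ cong₂ _+_ (ℕₚ.m≤n⇒∣m-n∣≡n∸m x₁≤x₂) (ℕₚ.m≤n⇒∣n-m∣≡n∸m y₂≤y₁) ⟩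
      (x₂ ∸ x₁) + (y₁ ∸ y₂)
        ≤⟨ ℕₚ.+-monoʳ-≤ (x₂ ∸ x₁) (ℕₚ.≤-trans (ℕₚ.m∸n≤m y₁ y₂) y₁≤x₁) ⟩
      (x₂ ∸ x₁) + x₁                   ≡⟨ ℕₚ.m∸n+n≡m x₁≤x₂ ⟩
      x₂                               ≤⟨ x₂≤L ⟩
      L (suc k)                        ≡⟨ L-suc k ⟩
      suc (S k)                        ∎

  -- If r is even and b odd, r - b is odd and lies in the octagon of B k.
  difference∈B : 1+i∣ pt x₁ y₁ → Odd (x₂ + y₂) → B k (pt x₁ y₁ -ᵍ pt x₂ y₂)
  difference∈B r-even b-odd = odd∈B k odd-ℓ1 ℓ∞-difference (odd-≤-S k odd-ℓ1 ℓ1-difference)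
    where
    b≡r-[r-b] : ∀ u v → v ≡ u +ᵍ negᵍ (u +ᵍ negᵍ v)
    b≡r-[r-b] = solve-∀ ℤ[i]-ring
    odd-ℓ1 : Odd (ℓ1 (pt x₁ y₁ -ᵍ pt x₂ y₂))
    odd-ℓ1 = ¬1+i∣⇒Odd-ℓ1 (pt x₁ y₁ -ᵍ pt x₂ y₂) λ r-b-even →
      1+i∣⇒¬Odd-ℓ1 (subst 1+i∣_ (sym (b≡r-[r-b] (pt x₁ y₁) (pt x₂ y₂)))
                                  (1+i∣-sub r-even r-b-even)) b-odd

octant-difference∈B : ∀ k {x₁ y₁ x₂ y₂} → y₁ ≤ x₁ → y₂ ≤ x₂ →
                      B (suc k) (pt x₂ y₂) → ¬ B k (pt x₁ y₁) →
                      x₁ + x₁ ≤ x₂ + y₂ → x₁ + y₁ ≤ x₂ → B k (pt x₁ y₁ -ᵍ pt x₂ y₂)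
octant-difference∈B k y₁≤x₁ y₂≤x₂ b∈B r∉B h₁ h₂ with octantView y₁≤x₁ | octantView y₂≤x₂
... | odd y₁ d  | _ = ⊥-elim (D.r-not-odd (octant-odd y₁ d))
  where module D = Octant-difference y₁≤x₁ y₂≤x₂ b∈B r∉B h₁ h₂
... | even y₁ d | odd y₂ c = D.difference∈B (pt-halve-1+i∣ y₁ d) (octant-odd y₂ c)
  where module D = Octant-difference y₁≤x₁ y₂≤x₂ b∈B r∉B h₁ h₂
octant-difference∈B zero y₁≤x₁ y₂≤x₂ b∈B r∉B h₁ h₂ | even y₁ d | even y₂ c =
  ⊥-elim (ℕₚ.<⇒≱ D.1+2P<x₁+y₁ (ℕₚ.≤-trans h₂ x₂≤1))
  where
  module D = Octant-difference y₁≤x₁ y₂≤x₂ b∈B r∉B h₁ h₂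
  x₂≤1 : y₂ + (c + c) ≤ 1
  x₂≤1 = subst (_≤ 1) (ℕₚ.+-assoc y₂ c c) (proj₂ (B-bounds 0 (B-halve y₂ c b∈B)))
-- Both points are even: halve them (swapping the two bounds) and recurse.
octant-difference∈B (suc k) y₁≤x₁ y₂≤x₂ b∈B r∉B h₁ h₂ | even y₁ d | even y₂ c =
  subst (B (suc k)) halved
    (Digits-1+i (Digits-conj (octant-difference∈B k (ℕₚ.m≤n+m d y₁) (ℕₚ.m≤n+m c y₂)
      (B-halve y₂ c b∈B) (λ r′∈B → r∉B (B-unhalve y₁ d r′∈B)) h₁′ h₂′)))
  where
  h₁′ : (y₁ + d) + (y₁ + d) ≤ (y₂ + c) + c
  h₁′ = subst₂ _≤_ (octant-halves y₁ d) (sym (ℕₚ.+-assoc y₂ c c)) h₂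
  h₂′ : (y₁ + d) + d ≤ y₂ + c
  h₂′ = half-≤ (ℕₚ.m≤n⇒m≤1+n (subst₂ _≤_ (cong₂ _+_ assoc assoc) (octant-halves y₂ c) h₁))
    where assoc = sym (ℕₚ.+-assoc y₁ d d)
  1+i*conj-sub : ∀ u v → 1+i *ᵍ conj (u -ᵍ v) ≡ 1+i *ᵍ conj u -ᵍ 1+i *ᵍ conj v
  1+i*conj-sub u v =
    trans (cong (1+i *ᵍ_) (mirror-sub true u v)) (sym (1+i*-distrib-sub (conj u) (conj v)))
  halved : 1+i *ᵍ conj (pt (y₁ + d) d -ᵍ pt (y₂ + c) c)
         ≡ pt (y₁ + (d + d)) y₁ -ᵍ pt (y₂ + (c + c)) y₂
  halved = trans (1+i*conj-sub (pt (y₁ + d) d) (pt (y₂ + c) c))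
                 (cong₂ _-ᵍ_ (sym (pt-halve y₁ d)) (sym (pt-halve y₂ c)))

division-errors : ∀ X n .{{_ : ℕ.NonZero n}} →
  X ℤ.- (X ℤ./ℕ n) ℤ.* + n ≡ + (X ℤ.%ℕ n) ×
  X ℤ.- (X ℤ./ℕ n ℤ.+ + 1) ℤ.* + n ≡ + (X ℤ.%ℕ n) ℤ.- + n
division-errors X n = errors (+ (X ℤ.%ℕ n)) (X ℤ./ℕ n) (+ n) (ℤ/.a≡a%ℕn+[a/ℕn]*n X n)
  where
  cancel : ∀ ρ q n → (ρ ℤ.+ q ℤ.* n) ℤ.- q ℤ.* n ≡ ρ
  cancel = ℤ-Solver.solve-∀
  cancel′ : ∀ ρ q n → (ρ ℤ.+ q ℤ.* n) ℤ.- (q ℤ.+ + 1) ℤ.* n ≡ ρ ℤ.- n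
  cancel′ = ℤ-Solver.solve-∀
  errors : ∀ {X} ρ q n → X ≡ ρ ℤ.+ q ℤ.* n → X ℤ.- q ℤ.* n ≡ ρ × X ℤ.- (q ℤ.+ + 1) ℤ.* n ≡ ρ ℤ.- n
  errors ρ q n refl = cancel ρ q n , cancel′ ρ q n

roundDiv-error : ∀ X n .{{_ : ℕ.NonZero n}} → 2 * ∣ X ℤ.- roundDiv X n ℤ.* + n ∣ ≤ n
roundDiv-error X n@(suc _) with 2 * (X ℤ.%ℕ n) ℕ.≤? n
... | yes 2ρ≤n = subst (λ e → 2 * ∣ e ∣ ≤ n) (sym (proj₁ (division-errors X n))) 2ρ≤n
... | no 2ρ≰n = subst (λ e → 2 * ∣ e ∣ ≤ n) (sym (proj₂ (division-errors X n))) (begin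
  2 * ∣ + ρ ℤ.- + n ∣   ≡⟨ cong (2 *_) (trans (∣+m-+n∣≡∣m-n∣ ρ n) (ℕₚ.m≤n⇒∣m-n∣≡n∸m ρ≤n)) ⟩
  2 * (n ∸ ρ)           ≡⟨ ℕₚ.*-distribˡ-∸ 2 n ρ ⟩
  2 * n ∸ 2 * ρ         ≤⟨ ℕₚ.∸-monoʳ-≤ (2 * n) (ℕₚ.<⇒≤ (ℕₚ.≰⇒> 2ρ≰n)) ⟩
  (n + (n + 0)) ∸ n     ≡⟨ trans (ℕₚ.m+n∸m≡n n (n + 0)) (ℕₚ.+-identityʳ n) ⟩
  n                     ∎)
  where
  open ℕₚ.≤-Reasoning
  ρ = X ℤ.%ℕ n
  ρ≤n : ρ ≤ n
  ρ≤n = ℕₚ.<⇒≤ (ℤ/.n%ℕd<d X n)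

Nm-conj : ∀ b → b *ᵍ conj b ≡ (+ Nm b) + (+ 0) i
Nm-conj (x + y i) = cong₂ _+_i (trans re≡ (sym (trans (ℤₚ.pos-+ (∣ x ∣ * ∣ x ∣) (∣ y ∣ * ∣ y ∣))
                                                 (cong₂ ℤ._+_ (square x) (square y))))) (im≡ x y)
  where
  re≡′ : ∀ x y → x ℤ.* x ℤ.- y ℤ.* (ℤ.- y) ≡ x ℤ.* x ℤ.+ y ℤ.* y
  re≡′ = ℤ-Solver.solve-∀
  re≡ = re≡′ x y
  im≡ : ∀ x y → x ℤ.* (ℤ.- y) ℤ.+ y ℤ.* x ≡ + 0
  im≡ = ℤ-Solver.solve-∀
  square : ∀ c → + (∣ c ∣ * ∣ c ∣) ≡ c ℤ.* c
  square (+ n)    = ℤₚ.pos-* n n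
  square -[1+ n ] = refl

Nm≢0 : ∀ {b} → b ≢ 0ᵍ → Nm b ≢ 0
Nm≢0 {x + y i} b≢0 Nm≡0 =
  b≢0 (cong₂ _+_i (vanishes x (ℕₚ.m+n≡0⇒m≡0 _ Nm≡0)) (vanishes y (ℕₚ.m+n≡0⇒n≡0 _ Nm≡0)))
  where
  vanishes : ∀ c → ∣ c ∣ * ∣ c ∣ ≡ 0 → c ≡ + 0
  vanishes c c²≡0 = ℤₚ.∣i∣≡0⇒i≡0 ([ (λ e → e) , (λ e → e) ]′ (ℕₚ.m*n≡0⇒m≡0∨n≡0 ∣ c ∣ c²≡0))

-- With N = Nm b and e = a b̄ - q N, the remainder satisfies N r = e b, while
-- the rounding gives 2 ℓ∞ e ≤ N; both bounds follow from ℓ∞ (u v) ≤ ℓ∞ u ℓ1 v.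
module Remainder (a b q : ℤ[i]) (N : ℕ) .{{_ : ℕ.NonZero N}} (Nm≡ : b *ᵍ conj b ≡ (+ N) + (+ 0) i)
  (re-error : 2 * ∣ re (a *ᵍ conj b) ℤ.- re q ℤ.* + N ∣ ≤ N)
  (im-error : 2 * ∣ im (a *ᵍ conj b) ℤ.- im q ℤ.* + N ∣ ≤ N) where

  r e : ℤ[i]
  r = a -ᵍ q *ᵍ b
  e = a *ᵍ conj b -ᵍ q *ᵍ ((+ N) + (+ 0) i)

  Nr≡eb : ((+ N) + (+ 0) i) *ᵍ r ≡ e *ᵍ b
  Nr≡eb = trans (cong (_*ᵍ r) (sym Nm≡))
         (trans (identity a b q (conj b)) (cong (λ n → (a *ᵍ conj b -ᵍ q *ᵍ n) *ᵍ b) Nm≡))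
    where
    identity : ∀ a b q B → (b *ᵍ B) *ᵍ (a +ᵍ negᵍ (q *ᵍ b)) ≡ (a *ᵍ B +ᵍ negᵍ (q *ᵍ (b *ᵍ B))) *ᵍ b
    identity = solve-∀ ℤ[i]-ring

  2ℓ∞e≤N : 2 * ℓ∞ e ≤ N
  2ℓ∞e≤N = subst (_≤ N) (sym (ℕₚ.*-distribˡ-⊔ 2 ∣ re e ∣ ∣ im e ∣)) (ℕₚ.⊔-lub
    (subst (λ c → 2 * ∣ c ∣ ≤ N) (sym (re-part (re (a *ᵍ conj b)) (re q) (im q) (+ N))) re-error)
    (subst (λ c → 2 * ∣ c ∣ ≤ N) (sym (im-part (im (a *ᵍ conj b)) (re q) (im q) (+ N))) im-error))
    where
    re-part : ∀ w₁ q₁ q₂ c → w₁ ℤ.- (q₁ ℤ.* c ℤ.- q₂ ℤ.* + 0) ≡ w₁ ℤ.- q₁ ℤ.* c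
    re-part = ℤ-Solver.solve-∀
    im-part : ∀ w₂ q₁ q₂ c → w₂ ℤ.- (q₁ ℤ.* + 0 ℤ.+ q₂ ℤ.* c) ≡ w₂ ℤ.- q₂ ℤ.* c
    im-part = ℤ-Solver.solve-∀

  2ℓ∞r≤ℓ1b : 2 * ℓ∞ r ≤ ℓ1 b
  2ℓ∞r≤ℓ1b = ℕₚ.*-cancelˡ-≤ N (begin
    N * (2 * ℓ∞ r)         ≡⟨ *-swap N 2 (ℓ∞ r) ⟩
    2 * (N * ℓ∞ r)         ≡⟨ cong (2 *_) (trans (sym (ℓ∞-scale N r)) (cong ℓ∞ Nr≡eb)) ⟩
    2 * ℓ∞ (e *ᵍ b)        ≤⟨ ℕₚ.*-monoʳ-≤ 2 (ℓ∞-*-≤ e b) ⟩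
    2 * (ℓ∞ e * ℓ1 b)      ≡⟨ ℕₚ.*-assoc 2 (ℓ∞ e) (ℓ1 b) ⟨
    2 * ℓ∞ e * ℓ1 b        ≤⟨ ℕₚ.*-monoˡ-≤ (ℓ1 b) 2ℓ∞e≤N ⟩
    N * ℓ1 b               ∎)
    where
    open ℕₚ.≤-Reasoning
    *-swap : ∀ m n o → m * (n * o) ≡ n * (m * o)
    *-swap = ℕ-Solver.solve-∀

  ℓ1r≤ℓ∞b : ℓ1 r ≤ ℓ∞ b
  ℓ1r≤ℓ∞b = ℕₚ.*-cancelˡ-≤ N (begin
    N * ℓ1 r               ≡⟨ trans (sym (ℓ1-scale N r)) (cong ℓ1 Nr≡eb) ⟩
    ℓ1 (e *ᵍ b)            ≡⟨ ℓ∞-1+i (e *ᵍ b) ⟨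
    ℓ∞ (1+i *ᵍ (e *ᵍ b))   ≡⟨ cong ℓ∞ (commute e b) ⟩
    ℓ∞ (e *ᵍ (1+i *ᵍ b))   ≤⟨ ℓ∞-*-≤ e (1+i *ᵍ b) ⟩
    ℓ∞ e * ℓ1 (1+i *ᵍ b)   ≡⟨ trans (cong (ℓ∞ e *_) (ℓ1-1+i b)) (doubling (ℓ∞ e) (ℓ∞ b)) ⟩
    2 * ℓ∞ e * ℓ∞ b        ≤⟨ ℕₚ.*-monoˡ-≤ (ℓ∞ b) 2ℓ∞e≤N ⟩
    N * ℓ∞ b               ∎)
    where
    open ℕₚ.≤-Reasoning
    doubling : ∀ m n → m * (n + n) ≡ 2 * m * n
    doubling = ℕ-Solver.solve-∀
    commute : ∀ e b → 1+i *ᵍ (e *ᵍ b) ≡ e *ᵍ (1+i *ᵍ b)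
    commute = solve-∀ ℤ[i]-ring

gaussRem-bounds : ∀ a b → b ≢ 0ᵍ →
  ℓ∞ (gaussRem a b) + ℓ∞ (gaussRem a b) ≤ ℓ1 b × ℓ1 (gaussRem a b) ≤ ℓ∞ b
gaussRem-bounds a b b≢0 = subst (_≤ ℓ1 b) (twice (ℓ∞ (gaussRem a b))) R.2ℓ∞r≤ℓ1b , R.ℓ1r≤ℓ∞b
  where
  instance
    Nm-nonZero : ℕ.NonZero (Nm b)
    Nm-nonZero = ℕ.≢-nonZero (Nm≢0 b≢0)
  module R = Remainder a b (gaussQuot a b) (Nm b) (Nm-conj b)
    (roundDiv-error (re (a *ᵍ conj b)) (Nm b)) (roundDiv-error (im (a *ᵍ conj b)) (Nm b))
  twice : ∀ m → 2 * m ≡ m + m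
  twice = ℕ-Solver.solve-∀

gaussRem-unit : ∀ a b → b ≢ 0ᵍ → B 0 b → gaussRem a b ≡ 0ᵍ
gaussRem-unit a b b≢0 b∈B = ℓ∞≡0⇒≡0ᵍ (gaussRem a b) (ℕₚ.n≤0⇒n≡0
  (half-≤ (ℕₚ.≤-trans (proj₁ (gaussRem-bounds a b b≢0)) (proj₂ (B-bounds 0 b∈B)))))

∃-Digit? : ∀ {P : Digit → Set} → (∀ d → Dec (P d)) → Dec (Σ Digit P)
∃-Digit? P? with P? d0 | P? (du u1) | P? (du u-1) | P? (du ui) | P? (du u-i)
... | yes p | _     | _     | _     | _     = yes (d0 , p)
... | _     | yes p | _     | _     | _     = yes (du u1 , p)
... | _     | _     | yes p | _     | _     = yes (du u-1 , p)
... | _     | _     | _     | yes p | _     = yes (du ui , p)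
... | _     | _     | _     | _     | yes p = yes (du u-i , p)
... | no ¬p₀ | no ¬p₁ | no ¬p₂ | no ¬p₃ | no ¬p₄ = no λ where
  (d0 , p)     → ¬p₀ p
  (du u1 , p)  → ¬p₁ p
  (du u-1 , p) → ¬p₂ p
  (du ui , p)  → ¬p₃ p
  (du u-i , p) → ¬p₄ p

∃-Vec? : ∀ {A : Set} → (∀ {P : A → Set} → (∀ a → Dec (P a)) → Dec (Σ A P)) →
         ∀ m {P : Vec A m → Set} → (∀ v → Dec (P v)) → Dec (Σ (Vec A m) P)
∃-Vec? ∃? zero    P? = map′ ([] ,_) (λ { ([] , p) → p }) (P? [])
∃-Vec? ∃? (suc m) P? = map′ (λ { (a , v , p) → a ∷ v , p }) (λ { (a ∷ v , p) → a , v , p })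
  (∃? λ a → ∃-Vec? ∃? m λ v → P? (a ∷ v))

Repr? : ∀ m z → Dec (Repr m z)
Repr? m z = ∃-Vec? ∃-Digit? (suc m) λ ds → nonzero? (last ds) ×-dec (evalDigits ds ≟ᵍ z)
  where
  nonzero? : ∀ d → Dec (d ≢ d0)
  nonzero? d0     = no λ d0≢d0 → d0≢d0 refl
  nonzero? (du u) = yes λ ()

least : ∀ {P : ℕ → Set} → (∀ n → Dec (P n)) → ∀ n → P n → ∃ λ k → k ≤ n × P k × (∀ m → m < k → ¬ P m)
least {P} P? = ℕ-Ind.<-rec _ search
  where
  search : ∀ n → (∀ {m} → m < n → P m → ∃ λ k → k ≤ m × P k × (∀ j → j < k → ¬ P j)) →
           P n → ∃ λ k → k ≤ n × P k × (∀ j → j < k → ¬ P j)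
  search n smaller Pn with ℕₚ.anyUpTo? P? n
  ... | no none = n , ℕₚ.≤-refl , Pn , λ j j<n Pj → none (j , j<n , Pj)
  ... | yes (m , m<n , Pm) with smaller m<n Pm
  ...   | k , k≤m , Pk , minimal = k , ℕₚ.≤-trans k≤m (ℕₚ.<⇒≤ m<n) , Pk , minimal

single-digit : ∀ d {w z} → w ≡ 0ᵍ → digitVal d +ᵍ 1+i *ᵍ w ≡ z → z ≢ 0ᵍ → Repr 0 z
single-digit d refl eq z≢0 = d ∷ [] , (λ { refl → z≢0 (sym eq) }) , eq

B⇒Repr : ∀ n {z} → z ≢ 0ᵍ → B n z → ∃ λ j → j ≤ n × Repr j z
B⇒Repr zero    z≢0 (d ∷ [] , eq) = 0 , z≤n , single-digit d refl eq z≢0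
B⇒Repr (suc n) z≢0 (d ∷ ds , eq) with evalDigits ds ≟ᵍ 0ᵍ
... | yes w≡0 = 0 , z≤n , single-digit d w≡0 eq z≢0
... | no w≢0 with B⇒Repr n w≢0 (ds , refl)
...   | j , j≤n , (ds′ , last≢0 , ds′≡) =
  suc j , s≤s j≤n , (d ∷ ds′ , last≢0 , trans (cong (λ w → digitVal d +ᵍ 1+i *ᵍ w) ds′≡) eq)

B⇒Phi : ∀ n {z} → z ≢ 0ᵍ → B n z → ∃ λ k → k ≤ n × Phi z k
B⇒Phi n {z} z≢0 z∈B with B⇒Repr n z≢0 z∈B
... | j , j≤n , repr with least (λ m → Repr? m z) j repr
...   | k , k≤j , repr-k , minimal = k , ℕₚ.≤-trans k≤j j≤n , repr-k , minimal

Phi⇒B : ∀ {z n} → Phi z n → B n z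
Phi⇒B ((ds , _ , eq) , _) = ds , eq

Phi⇒∉B : ∀ {z m k} → z ≢ 0ᵍ → Phi z m → k < m → ¬ B k z
Phi⇒∉B {k = k} z≢0 (_ , minimal) k<m z∈B with B⇒Repr k z≢0 z∈B
... | j , j≤k , repr = minimal j (ℕₚ.≤-<-trans j≤k k<m) repr

cone : ∀ z u → IsUz z u → ∃ λ Y → toℤ[i] u *ᵍ z ≡ (+ ℓ∞ z) + Y i × ∣ Y ∣ ≤ ℓ∞ z
cone z u (unequal , equal) =
  im w , cong₂ _+_i re≡ refl , subst (∣ im w ∣ ≤_) (ℓ∞-unit u z) (ℕₚ.m≤n⊔m ∣ re w ∣ ∣ im w ∣)
  where
  w = toℤ[i] u *ᵍ z
  re≡ : re w ≡ + ℓ∞ z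
  re≡ with ℓ∞ z ℕ.≟ mᵍ z
  ... | yes ℓ∞≡m = cong re (equal ℓ∞≡m)
  ... | no ℓ∞≢m  = unequal ℓ∞≢m

common-fold : ∀ X₁ Y₁ X₂ Y₂ → + 0 ℤ.≤ Y₂ ℤ.* Y₁ →
  ∃ λ s → mirror s ((+ X₁) + Y₁ i) ≡ pt X₁ ∣ Y₁ ∣ × mirror s ((+ X₂) + Y₂ i) ≡ pt X₂ ∣ Y₂ ∣
common-fold X₁ (+ y₁)     X₂ (+ y₂)     _  = false , refl , refl
common-fold X₁ -[1+ y₁ ]  X₂ -[1+ y₂ ]  _  = true , refl , refl
common-fold X₁ -[1+ y₁ ]  X₂ (+ zero)   _  = true , refl , refl
common-fold X₁ (+ zero)   X₂ -[1+ y₂ ]  _  = true , refl , refl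
common-fold X₁ -[1+ y₁ ]  X₂ (+ suc y₂) ()
common-fold X₁ (+ suc y₁) X₂ -[1+ y₂ ]  ()

record Folding (r b : ℤ[i]) (ur ub : Unit) : Set where
  field
    s      : Bool
    y₁ y₂  : ℕ
    y₁≤x₁  : y₁ ≤ ℓ∞ r
    y₂≤x₂  : y₂ ≤ ℓ∞ b
    r-fold : mirror s (toℤ[i] ur *ᵍ r) ≡ pt (ℓ∞ r) y₁
    b-fold : mirror s (toℤ[i] ub *ᵍ b) ≡ pt (ℓ∞ b) y₂

folding : ∀ r b ur ub → IsUz r ur → IsUz b ub →
          + 0 ℤ.≤ im (toℤ[i] ub *ᵍ b) ℤ.* im (toℤ[i] ur *ᵍ r) → Folding r b ur ub
folding r b ur ub r-uz b-uz same-side with cone r ur r-uz | cone b ub b-uz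
... | Y₁ , r≡ , ∣Y₁∣≤ | Y₂ , b≡ , ∣Y₂∣≤
  with common-fold (ℓ∞ r) Y₁ (ℓ∞ b) Y₂
         (subst₂ (λ p q → + 0 ℤ.≤ p ℤ.* q) (cong im b≡) (cong im r≡) same-side)
...   | s , r-fold , b-fold = record
  { s = s ; y₁ = ∣ Y₁ ∣ ; y₂ = ∣ Y₂ ∣ ; y₁≤x₁ = ∣Y₁∣≤ ; y₂≤x₂ = ∣Y₂∣≤
  ; r-fold = trans (cong (mirror s) r≡) r-fold ; b-fold = trans (cong (mirror s) b≡) b-fold }

*ᵍ-sub-/ᵘ : ∀ u v r b → toℤ[i] u *ᵍ (r -ᵍ (v /ᵘ u) *ᵍ b) ≡ toℤ[i] u *ᵍ r -ᵍ toℤ[i] v *ᵍ b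
*ᵍ-sub-/ᵘ u v r b = begin
  U *ᵍ (r -ᵍ (v /ᵘ u) *ᵍ b)             ≡⟨ expand U V r b (conj U) ⟩
  U *ᵍ r -ᵍ (U *ᵍ conj U) *ᵍ (V *ᵍ b)   ≡⟨ cong (λ n → U *ᵍ r -ᵍ n *ᵍ (V *ᵍ b)) (unit-norm u) ⟩
  U *ᵍ r -ᵍ 1ᵍ *ᵍ (V *ᵍ b)              ≡⟨ cong (U *ᵍ r -ᵍ_) (*ᵍ-identityˡ (V *ᵍ b)) ⟩
  U *ᵍ r -ᵍ V *ᵍ b                      ∎
  where
  open ≡-Reasoning
  U = toℤ[i] u
  V = toℤ[i] v
  expand : ∀ w c r b w̄ → w *ᵍ (r +ᵍ negᵍ ((c *ᵍ w̄) *ᵍ b)) ≡ w *ᵍ r +ᵍ negᵍ ((w *ᵍ w̄) *ᵍ (c *ᵍ b))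
  expand = solve-∀ ℤ[i]-ring
  unit-norm : ∀ u → toℤ[i] u *ᵍ conj (toℤ[i] u) ≡ 1ᵍ
  unit-norm u1  = refl
  unit-norm ui  = refl
  unit-norm u-1 = refl
  unit-norm u-i = refl

≡-from-difference : ∀ {u v} → u -ᵍ v ≡ 0ᵍ → u ≡ v
≡-from-difference {u} {v} u-v≡0 = trans (restore u v) (trans (cong (_+ᵍ v) u-v≡0) (+ᵍ-identityˡ v))
  where
  restore : ∀ u v → u ≡ (u +ᵍ negᵍ v) +ᵍ v
  restore = solve-∀ ℤ[i]-ring

pt-injective : ∀ {a b c d} → pt a b ≡ pt c d → a ≡ c × b ≡ d
pt-injective eq = ℤₚ.+-injective (cong re eq) , ℤₚ.+-injective (cong im eq)

octant-difference≢0 : ∀ {x₁ y₁ x₂ y₂} → 0 < x₁ → x₁ + x₁ ≤ x₂ + y₂ → x₁ + y₁ ≤ x₂ →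
                      pt x₁ y₁ -ᵍ pt x₂ y₂ ≢ 0ᵍ
octant-difference≢0 {x₁} {y₁} {x₂} {y₂} 0<x₁ 2x₁≤ x₁+y₁≤ D≡0
  with pt-injective {x₁} {y₁} {x₂} {y₂} (≡-from-difference D≡0)
... | refl , refl = ℕₚ.<⇒≱ 0<x₁ (ℕₚ.≤-trans (ℕₚ.+-cancelˡ-≤ x₁ x₁ y₁ 2x₁≤)
  (ℕₚ.+-cancelˡ-≤ x₁ y₁ 0 (subst (x₁ + y₁ ≤_) (sym (ℕₚ.+-identityʳ x₁)) x₁+y₁≤)))

ℓ1-fold : ∀ s u z {x y} → mirror s (toℤ[i] u *ᵍ z) ≡ pt x y → ℓ1 z ≡ x + y
ℓ1-fold s u z fold = trans (sym (trans (ℓ1-mirror s _) (ℓ1-unit u z))) (cong ℓ1 fold)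

module Folded-remainder {r b ur ub} (F : Folding r b ur ub) (r≢0 : r ≢ 0ᵍ)
  (2ℓ∞r≤ℓ1b : ℓ∞ r + ℓ∞ r ≤ ℓ1 b) (ℓ1r≤ℓ∞b : ℓ1 r ≤ ℓ∞ b) where
  open Folding F

  2x₁≤x₂+y₂ : ℓ∞ r + ℓ∞ r ≤ ℓ∞ b + y₂
  2x₁≤x₂+y₂ = subst (ℓ∞ r + ℓ∞ r ≤_) (ℓ1-fold s ub b b-fold) 2ℓ∞r≤ℓ1b

  x₁+y₁≤x₂ : ℓ∞ r + y₁ ≤ ℓ∞ b
  x₁+y₁≤x₂ = subst (_≤ ℓ∞ b) (ℓ1-fold s ur r r-fold) ℓ1r≤ℓ∞b

  shifted-fold : mirror s (toℤ[i] ur *ᵍ (r -ᵍ (ub /ᵘ ur) *ᵍ b)) ≡ pt (ℓ∞ r) y₁ -ᵍ pt (ℓ∞ b) y₂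
  shifted-fold = trans (cong (mirror s) (*ᵍ-sub-/ᵘ ur ub r b))
                       (trans (mirror-sub s _ _) (cong₂ _-ᵍ_ r-fold b-fold))

  shifted≢0 : r -ᵍ (ub /ᵘ ur) *ᵍ b ≢ 0ᵍ
  shifted≢0 z≡0 = octant-difference≢0 0<x₁ 2x₁≤x₂+y₂ x₁+y₁≤x₂ (ℓ∞≡0⇒≡0ᵍ _ (begin
    ℓ∞ (pt (ℓ∞ r) y₁ -ᵍ pt (ℓ∞ b) y₂)                      ≡⟨ cong ℓ∞ shifted-fold ⟨
    ℓ∞ (mirror s (toℤ[i] ur *ᵍ (r -ᵍ (ub /ᵘ ur) *ᵍ b)))   ≡⟨ ℓ∞-mirror s _ ⟩
    ℓ∞ (toℤ[i] ur *ᵍ (r -ᵍ (ub /ᵘ ur) *ᵍ b))              ≡⟨ ℓ∞-unit ur _ ⟩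
    ℓ∞ (r -ᵍ (ub /ᵘ ur) *ᵍ b)                             ≡⟨ cong ℓ∞ z≡0 ⟩
    0                                                     ∎))
    where
    open ≡-Reasoning
    0<x₁ : 0 < ℓ∞ r
    0<x₁ = ℕₚ.n≢0⇒n>0 (λ ℓ∞≡0 → r≢0 (ℓ∞≡0⇒≡0ᵍ r ℓ∞≡0))

  shifted∈B : ∀ k → B (suc k) b → ¬ B k r → B k (r -ᵍ (ub /ᵘ ur) *ᵍ b)
  shifted∈B k b∈B r∉B = subst (B k) (sym (σ-inverse ur s shifted-fold))
    (Digits-σ (ur ⁻¹) s (octant-difference∈B k y₁≤x₁ y₂≤x₂ b′∈B r′∉B 2x₁≤x₂+y₂ x₁+y₁≤x₂))
    where
    b′∈B : B (suc k) (pt (ℓ∞ b) y₂)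
    b′∈B = subst (B (suc k)) b-fold (Digits-mirror s (Digits-unit ub b∈B))
    r′∉B : ¬ B k (pt (ℓ∞ r) y₁)
    r′∉B r′∈B = r∉B (subst (B k) (sym (σ-inverse ur s r-fold)) (Digits-σ (ur ⁻¹) s r′∈B))

proposition1 : (a b r : ℤ[i]) (ub ur : Unit) (n m : ℕ) →
    a ≢ 0ᵍ → b ≢ 0ᵍ → r ≡ gaussRem a b → r ≢ 0ᵍ →
    Phi b n → Phi r m → n ≤ m →
    IsUz b ub → IsUz r ur →
    + 0 ℤ.≤ im (toℤ[i] ub *ᵍ b) ℤ.* im (toℤ[i] ur *ᵍ r) →
    ∃ λ k → Phi (r -ᵍ (ub /ᵘ ur) *ᵍ b) k × k < n
proposition1 a b r ub ur zero m _ b≢0 refl r≢0 φb _ _ _ _ _ =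
  ⊥-elim (r≢0 (gaussRem-unit a b b≢0 (Phi⇒B φb)))
proposition1 a b r ub ur (suc k) m _ b≢0 refl r≢0 φb φr k<m b-uz r-uz same-side =
  let k′ , k′≤k , φz = B⇒Phi k R.shifted≢0 (R.shifted∈B k (Phi⇒B φb) (Phi⇒∉B r≢0 φr k<m))
  in k′ , φz , s≤s k′≤k
  where
  module R = Folded-remainder (folding r b ur ub r-uz b-uz same-side) r≢0
               (proj₁ (gaussRem-bounds a b b≢0)) (proj₂ (gaussRem-bounds a b b≢0))
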